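{- Let $m,n$ be positive integers with $m\equiv 2\pmod 4$ and $n\equiv 2\pmod 4$. Then there exists a cyclic and $\phi_n$-symmetric hamiltonian cycle system of $K_{m\times n}$.
   Context: $K_{m\times n}$ is the complete multipartite graph with $m$ parts of size $n$, with vertex set identified with $\mathbb{Z}_{mn}$, parts the cosets of $m\mathbb{Z}_{mn}$, and $x,y$ adjacent iff $x-y\notin m\mathbb{Z}_{mn}$. A hamiltonian cycle system is a set of hamiltonian cycles whose edge sets partition the edge set; it is cyclic if it is closed under adding $1$ to all vertices of a cycle. $\phi_n$ is the map $x\mapsto x+m$ on $\mathbb{Z}_{mn}$; the system is $\phi_n$-symmetric if each of its cycles is mapped to itself by $\phi_n$. -}

module Defs where

open import Data.Nat using (ℕ; suc; _*_; _+_; _<_; NonZero)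
open import Data.Nat.DivMod using (_%_)
open import Data.Nat.Properties using (m*n≢0)
open import Data.Fin using (Fin)
open import Data.Product using (Σ; ∃; _×_; _,_)
open import Data.Sum using (_⊎_)
open import Relation.Nullary using (¬_)
open import Relation.Binary.PropositionalEquality using (_≡_)

-- Everything is relative to K_{m×n} on vertex set ℤ_{mn}, represented as
-- the naturals x < m * n.  Arithmetic in ℤ_{mn} is done with _%_ (m * n).
module _ (m n : ℕ) .{{_ : NonZero m}} .{{_ : NonZero n}} where

  N : ℕ
  N = m * n

  instance
    N≢0 : NonZero N
    N≢0 = m*n≢0 m n

  -- x,y adjacent in K_{m×n}: x - y ∉ mℤ_{mn}, i.e. x, y lie in different
  -- cosets of mℤ_{mn}; since m ∣ mn this is x mod m ≠ y mod m.
  Adj : ℕ → ℕ → Set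
  Adj x y = x < N × y < N × ¬ (x % m ≡ y % m)

  record HamCycle : Set where
    field
      vert    : ℕ → ℕ
      inRange : ∀ i → i < N → vert i < N
      inj     : ∀ i j → i < N → j < N → vert i ≡ vert j → i ≡ j
      adj     : ∀ i → i < N → Adj (vert i) (vert (suc i % N))
  open HamCycle public

  HasEdge : (ℕ → ℕ) → ℕ → ℕ → Set
  HasEdge v x y = ∃ λ i → i < N ×
    ((v i ≡ x × v (suc i % N) ≡ y) ⊎ (v i ≡ y × v (suc i % N) ≡ x))

  -- Two (vertex sequences of) cycles are the same cycle: same edge set.
  SameEdges : (ℕ → ℕ) → (ℕ → ℕ) → Set
  SameEdges v w = ∀ x y → (HasEdge v x y → HasEdge w x y) × (HasEdge w x y → HasEdge v x y)

  shift : ℕ → (ℕ → ℕ) → (ℕ → ℕ)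
  shift s v i = (v i + s) % N

  record HCS : Set where
    field
      size   : ℕ
      cycle  : Fin size → HamCycle
      part   : ∀ x y → Adj x y →
               Σ (Fin size) λ i → HasEdge (vert (cycle i)) x y ×
                 (∀ j → HasEdge (vert (cycle j)) x y → j ≡ i)
  open HCS public

  Cyclic : HCS → Set
  Cyclic S = ∀ i → ∃ λ j → SameEdges (shift 1 (vert (cycle S i))) (vert (cycle S j))

  -- φ_n-symmetric: each cycle is mapped to itself by φ_n : x ↦ x + m
  PhiSymmetric : HCS → Set
  PhiSymmetric S = ∀ i → SameEdges (shift m (vert (cycle S i))) (vert (cycle S i))

-- Write n = 2ℓ, so mn = ℓ · 2m.  Call a difference d ∈ ℤ_mn positive when
-- d mod 2m lies strictly between 0 and m; for every edge {x , y} exactly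
-- one of y - x, x - y is positive, and the positive differences below mn
-- are the numbers ρ + u·2m with 0 < ρ < m and u < ℓ.  A template of
-- period g ∣ m is a sequence of offsets, distinct modulo g, in which each
-- step is ± a positive difference (the last step leading to g plus the first
-- offset); developing it periodically, x_{j+g} = x_j + g, gives a
-- hamiltonian cycle, whose g translates are permuted by x ↦ x + 1 and each
-- fixed by x ↦ x + m.  A *design* is a family of templates using every
-- positive difference exactly once; its developed cycles form a cyclic,
-- φ_n-symmetric hamiltonian cycle system (module Framework).
--
-- The theorem then reduces to two explicit designs: one for m = 2
-- (module SmallDesign) and one for m = 2(2a + 3) (module LargeDesign),
-- both for n = 2(2b + 1).
module Submission where

open import Defs
open import Data.Nat using (ℕ; NonZero)
open import Data.Nat.DivMod using (_%_)
open import Data.Product using (Σ; _×_)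
open import Relation.Binary.PropositionalEquality using (_≡_)

module Congruence where

  open import Data.Nat
  open import Data.Nat.Properties
  open import Data.Nat.DivMod
  open import Data.Nat.Divisibility
  open import Relation.Binary.PropositionalEquality

  infix 4 _≡[_]_
  _≡[_]_ : ℕ → (M : ℕ) → .{{_ : NonZero M}} → ℕ → Set
  a ≡[ M ] b = a % M ≡ b % M

  module _ {M : ℕ} .{{_ : NonZero M}} where

    mod-+ : ∀ {a b c d} → a ≡[ M ] b → c ≡[ M ] d → a + c ≡[ M ] b + d
    mod-+ {a} {b} {c} {d} p q = begin
        (a + c) % M         ≡⟨ %-distribˡ-+ a c M ⟩
        (a % M + c % M) % M ≡⟨ cong₂ (λ x y → (x + y) % M) p q ⟩
        (b % M + d % M) % M ≡⟨ sym (%-distribˡ-+ b d M) ⟩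
        (b + d) % M         ∎
      where open ≡-Reasoning

    add-multiple : ∀ a k → a + k * M ≡[ M ] a
    add-multiple a k = [m+kn]%n≡m%n a k M

    multiple≡0 : ∀ k → k * M ≡[ M ] 0
    multiple≡0 k = add-multiple 0 k

    mod-reduce : ∀ a → a % M ≡[ M ] a
    mod-reduce a = m%n%n≡m%n a M

    mod-unique : ∀ {a b} → a < M → b < M → a ≡[ M ] b → a ≡ b
    mod-unique {a} {b} p q e = trans (sym (m<n⇒m%n≡m p)) (trans e (m<n⇒m%n≡m q))

    0%M : 0 % M ≡ 0
    0%M = m<n⇒m%n≡m (n≢0⇒n>0 (≢-nonZero⁻¹ M))

    negate : ℕ → ℕ
    negate c = M ∸ c % M

    +-negate : ∀ c → c + negate c ≡[ M ] 0
    +-negate c = begin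
        (c + (M ∸ c % M)) % M     ≡⟨ mod-+ {c} {c % M} (sym (mod-reduce c)) refl ⟩
        (c % M + (M ∸ c % M)) % M ≡⟨ cong (_% M) (m+[n∸m]≡n (<⇒≤ (m%n<n c M))) ⟩
        M % M                     ≡⟨ n%n≡0 M ⟩
        0                         ≡⟨ sym 0%M ⟩
        0 % M                     ∎
      where open ≡-Reasoning

    mod-cancelʳ : ∀ {a b} c → a + c ≡[ M ] b + c → a ≡[ M ] b
    mod-cancelʳ {a} {b} c e = begin
        a % M                    ≡⟨ cong (_% M) (sym (+-identityʳ a)) ⟩
        (a + 0) % M              ≡⟨ mod-+ {a} {a} refl (sym (+-negate c)) ⟩
        (a + (c + negate c)) % M ≡⟨ cong (_% M) (sym (+-assoc a c (negate c))) ⟩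
        (a + c + negate c) % M   ≡⟨ mod-+ {a + c} {b + c} e refl ⟩
        (b + c + negate c) % M   ≡⟨ cong (_% M) (+-assoc b c (negate c)) ⟩
        (b + (c + negate c)) % M ≡⟨ mod-+ {b} {b} refl (+-negate c) ⟩
        (b + 0) % M              ≡⟨ cong (_% M) (+-identityʳ b) ⟩
        b % M                    ∎
      where open ≡-Reasoning

    mod-cancelˡ : ∀ {a b} c → c + a ≡[ M ] c + b → a ≡[ M ] b
    mod-cancelˡ {a} {b} c e =
      mod-cancelʳ c (trans (cong (_% M) (+-comm a c)) (trans e (cong (_% M) (+-comm c b))))

    rem-unique : ∀ q r → r < M → (r + q * M) % M ≡ r
    rem-unique q r r<M = trans ([m+kn]%n≡m%n r q M) (m<n⇒m%n≡m r<M)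

    quot-unique : ∀ q r → r < M → (r + q * M) / M ≡ q
    quot-unique q r r<M = begin
        (r + q * M) / M   ≡⟨ +-distrib-/ r (q * M) small ⟩
        r / M + q * M / M ≡⟨ cong₂ _+_ (m<n⇒m/n≡0 r<M) (m*n/n≡m q M) ⟩
        q                 ∎
      where
        open ≡-Reasoning
        small : r % M + (q * M) % M < M
        small = subst (λ z → r % M + z < M) (sym (m*n%n≡0 q M))
                  (subst (_< M) (sym (+-identityʳ (r % M))) (m%n<n r M))

    mod-+ʳ : ∀ {a b} c → a ≡[ M ] b → a + c ≡[ M ] b + c
    mod-+ʳ {a} {b} c p = mod-+ {a} {b} {c} {c} p refl

    mod-+ˡ : ∀ c {a b} → a ≡[ M ] b → c + a ≡[ M ] c + b
    mod-+ˡ c {a} {b} p = mod-+ {c} {c} {a} {b} refl p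

    negate-cancel : ∀ s a → a + (s + negate a) % M ≡[ M ] s
    negate-cancel s a = begin
        (a + (s + negate a) % M) % M ≡⟨ mod-+ˡ a (mod-reduce (s + negate a)) ⟩
        (a + (s + negate a)) % M     ≡⟨ cong (_% M) (regroup a s (negate a)) ⟩
        (s + (a + negate a)) % M     ≡⟨ mod-+ˡ s (+-negate a) ⟩
        (s + 0) % M                  ≡⟨ cong (_% M) (+-identityʳ s) ⟩
        s % M                        ∎
      where
        open ≡-Reasoning
        regroup : ∀ a s b → a + (s + b) ≡ s + (a + b)
        regroup a s b = trans (sym (+-assoc a s b)) (trans (cong (_+ b) (+-comm a s)) (+-assoc s a b))

    divmod : ∀ a → a ≡ a % M + (a / M) * M
    divmod a = m≡m%n+[m/n]*n a M

  mod-divisor : ∀ {M d} .{{_ : NonZero M}} .{{_ : NonZero d}} → d ∣ M →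
                ∀ {a b} → a ≡[ M ] b → a ≡[ d ] b
  mod-divisor {M} {d} d∣M {a} {b} e =
    trans (sym (m∣n⇒o%n%m≡o%m d M a d∣M)) (trans (cong (_% d) e) (m∣n⇒o%n%m≡o%m d M b d∣M))


module Parity where

  open import Data.Nat
  open import Data.Nat.Properties using (even≢odd; *-comm)
  open import Data.Bool using (Bool; true; false; not)
  open import Data.Product
  open import Data.Sum
  open import Relation.Binary.PropositionalEquality

  odd : ℕ → Bool
  odd zero = false
  odd (suc n) = not (odd n)

  parity-view : ∀ r → (Σ ℕ λ k → r ≡ k * 2 × odd r ≡ false) ⊎ (Σ ℕ λ k → r ≡ 1 + k * 2 × odd r ≡ true)
  parity-view zero = inj₁ (0 , refl , refl)
  parity-view (suc r) with parity-view r
  ... | inj₁ (k , e , o) = inj₂ (k , cong suc e , cong not o)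
  ... | inj₂ (k , e , o) = inj₁ (suc k , cong suc e , cong not o)

  odd-even : ∀ k → odd (k * 2) ≡ false
  odd-even zero = refl
  odd-even (suc k) = cong (λ z → not (not z)) (odd-even k)

  odd-odd : ∀ k → odd (1 + k * 2) ≡ true
  odd-odd k = cong not (odd-even k)

  even≢odd′ : ∀ k k' → k * 2 ≢ 1 + k' * 2
  even≢odd′ k k' e = even≢odd k k' (trans (*-comm 2 k) (trans e (cong suc (*-comm k' 2))))

  false≢true : false ≢ true
  false≢true ()


module Framework where

  open import Defs
  open Congruence
  open import Data.Nat
  open import Data.Nat.Properties
  open import Data.Nat.DivMod
  open import Data.Nat.Divisibility
  open import Data.Nat.Tactic.RingSolver
  open import Data.Product
  open import Data.Sum
  open import Data.Bool using (Bool; true; false)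
  open import Data.Fin using (Fin; toℕ; fromℕ<)
  open import Data.Fin.Properties using (toℕ<n; toℕ-injective; toℕ-fromℕ<)
  open import Function using (_∘_)
  open import Relation.Nullary
  open import Relation.Binary.Definitions using (tri<; tri≈; tri>)
  open import Relation.Binary.PropositionalEquality
  open import Data.Empty

  -- Enumeration of the pairs (t , c) with t < T and c < size t by the
  -- numbers below start T = size 0 + … + size (T - 1); the cycles of the
  -- system are indexed this way.
  module Enumeration (size : ℕ → ℕ) where

    start : ℕ → ℕ
    start zero = 0
    start (suc t) = start t + size t

    start-mono : ∀ a b → a ≤ b → start a ≤ start b
    start-mono a zero z≤n = ≤-refl
    start-mono a (suc b) le with m≤n⇒m<n∨m≡n le
    ... | inj₁ lt = ≤-trans (start-mono a b (≤-pred lt)) (m≤m+n (start b) (size b))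
    ... | inj₂ refl = ≤-refl

    split-index : ∀ T k → k < start T →
                  Σ ℕ λ t → Σ ℕ λ c → t < T × c < size t × k ≡ start t + c
    split-index zero k ()
    split-index (suc T) k k< with k <? start T
    ... | yes k<′ with split-index T k k<′
    ...   | t , c , t< , c< , e = t , c , m<n⇒m<1+n t< , c< , e
    split-index (suc T) k k< | no k≮ = T , k ∸ start T , n<1+n T , rest< , sym k≡
      where
        k≡ : start T + (k ∸ start T) ≡ k
        k≡ = m+[n∸m]≡n (≮⇒≥ k≮)
        rest< : k ∸ start T < size T
        rest< = +-cancelˡ-< (start T) (k ∸ start T) (size T) (subst (_< start T + size T) (sym k≡) k<)

    start-below : ∀ t t' c c' → c < size t → t < t' → start t + c < start t' + c'
    start-below t t' c c' c< t<t' =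
      ≤-trans (+-monoʳ-< (start t) c<) (≤-trans (start-mono (suc t) t' t<t') (m≤m+n (start t') c'))

    split-unique : ∀ t t' c c' → c < size t → c' < size t' → start t + c ≡ start t' + c' → t ≡ t'
    split-unique t t' c c' c< c'< e with <-cmp t t'
    ... | tri≈ _ t≡t' _ = t≡t'
    ... | tri< t<t' _ _ = ⊥-elim (<-irrefl e (start-below t t' c c' c< t<t'))
    ... | tri> _ _ t'<t = ⊥-elim (<-irrefl (sym e) (start-below t' t c' c c'< t'<t))

    module Indexed (T : ℕ) where

      total : ℕ
      total = start T

      split : (k : Fin total) → Σ ℕ λ t → Σ ℕ λ c → t < T × c < size t × toℕ k ≡ start t + c
      split k = split-index T (toℕ k) (toℕ<n k)

      blockOf : Fin total → ℕ
      blockOf k = proj₁ (split k)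

      entryOf : Fin total → ℕ
      entryOf k = proj₁ (proj₂ (split k))

      blockOf< : ∀ k → blockOf k < T
      blockOf< k = proj₁ (proj₂ (proj₂ (split k)))

      entryOf< : ∀ k → entryOf k < size (blockOf k)
      entryOf< k = proj₁ (proj₂ (proj₂ (proj₂ (split k))))

      split-spec : ∀ k → toℕ k ≡ start (blockOf k) + entryOf k
      split-spec k = proj₂ (proj₂ (proj₂ (proj₂ (split k))))

      index< : ∀ t c → t < T → c < size t → start t + c < total
      index< t c t< c< = ≤-trans (+-monoʳ-< (start t) c<) (start-mono (suc t) T t<)

      index : ∀ t c → t < T → c < size t → Fin total
      index t c t< c< = fromℕ< (index< t c t< c<)

      index-of : ∀ k t c (t< : t < T) (c< : c < size t) → blockOf k ≡ t → entryOf k ≡ c → k ≡ index t c t< c<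
      index-of k t c t< c< e e' = toℕ-injective
        (trans (split-spec k) (trans (cong₂ (λ a b → start a + b) e e') (sym (toℕ-fromℕ< (index< t c t< c<)))))

      of-index : ∀ t c (t< : t < T) (c< : c < size t) →
                 blockOf (index t c t< c<) ≡ t × entryOf (index t c t< c<) ≡ c
      of-index t c t< c< = block≡ , entry≡
        where
          k : Fin total
          k = index t c t< c<
          positions : start (blockOf k) + entryOf k ≡ start t + c
          positions = trans (sym (split-spec k)) (toℕ-fromℕ< (index< t c t< c<))
          block≡ : blockOf k ≡ t
          block≡ = split-unique (blockOf k) t (entryOf k) c (entryOf< k) c< positions
          entry≡ : entryOf k ≡ c
          entry≡ = +-cancelˡ-≡ (start t) (entryOf k) c (trans (cong (λ z → start z + entryOf k) (sym block≡)) positions)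

  -- pick o x y is x when o is true and y otherwise: the tail of an edge
  -- traversed in direction o.
  pick : Bool → ℕ → ℕ → ℕ
  pick true x y = x
  pick false x y = y

  module Frame (m ℓ : ℕ) .{{_ : NonZero m}} .{{_ : NonZero ℓ}} where

    n : ℕ
    n = 2 * ℓ

    instance
      n≢0 : NonZero n
      n≢0 = m*n≢0 2 ℓ

    mn : ℕ
    mn = N m n

    instance
      mn≢0 : NonZero mn
      mn≢0 = m*n≢0 m n

    twoM : ℕ
    twoM = 2 * m

    instance
      twoM≢0 : NonZero twoM
      twoM≢0 = m*n≢0 2 m

    mn≡ℓ*twoM : mn ≡ ℓ * twoM
    mn≡ℓ*twoM = regroup m ℓ
      where
        regroup : ∀ m ℓ → m * (2 * ℓ) ≡ ℓ * (2 * m)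
        regroup = solve-∀

    twoM∣mn : twoM ∣ mn
    twoM∣mn = divides ℓ mn≡ℓ*twoM

    m∣mn : m ∣ mn
    m∣mn = divides n (*-comm m n)

    m∣twoM : m ∣ twoM
    m∣twoM = divides 2 refl

    Step : Bool → ℕ → ℕ → ℕ → Set
    Step true a x y = x + a ≡[ mn ] y
    Step false a x y = x ≡[ mn ] y + a

    develop : ∀ o a x y k → Step o a x y → Step o a ((k + x) % mn) ((k + y) % mn)
    develop true a x y k e = begin
        ((k + x) % mn + a) % mn ≡⟨ mod-+ʳ {mn} a (mod-reduce {mn} (k + x)) ⟩
        (k + x + a) % mn        ≡⟨ cong (_% mn) (+-assoc k x a) ⟩
        (k + (x + a)) % mn      ≡⟨ mod-+ˡ {mn} k e ⟩
        (k + y) % mn            ≡⟨ sym (mod-reduce {mn} (k + y)) ⟩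
        (k + y) % mn % mn       ∎
      where open ≡-Reasoning
    develop false a x y k e = begin
        (k + x) % mn % mn       ≡⟨ mod-reduce {mn} (k + x) ⟩
        (k + x) % mn            ≡⟨ mod-+ˡ {mn} k e ⟩
        (k + (y + a)) % mn      ≡⟨ cong (_% mn) (sym (+-assoc k y a)) ⟩
        (k + y + a) % mn        ≡⟨ sym (mod-+ʳ {mn} a (mod-reduce {mn} (k + y))) ⟩
        ((k + y) % mn + a) % mn ∎
      where open ≡-Reasoning

    step-functional : ∀ o a s y y' → Step o a s y → Step o a s y' → y ≡[ mn ] y'
    step-functional true a s y y' e e' = trans (sym e) e'
    step-functional false a s y y' e e' = mod-cancelʳ {mn} {y} {y'} a (trans (sym e) e')

    step-crosses-parts : ∀ o a x y → Step o a x y → ¬ (a ≡[ m ] 0) → ¬ (x ≡[ m ] y)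
    step-crosses-parts true a x y e a≢0 x≡y =
      a≢0 (mod-cancelˡ {m} x (trans (mod-divisor m∣mn e) (trans (sym x≡y) (cong (_% m) (sym (+-identityʳ x))))))
    step-crosses-parts false a x y e a≢0 x≡y =
      a≢0 (mod-cancelˡ {m} y (trans (sym (mod-divisor m∣mn e)) (trans x≡y (cong (_% m) (sym (+-identityʳ y))))))

    pick-step : ∀ o a x y → x + a ≡[ mn ] y → Step o a (pick o x y) (pick o y x)
    pick-step true a x y e = e
    pick-step false a x y e = sym e

    pick< : ∀ o {x y} → x < mn → y < mn → pick o x y < mn
    pick< true x< y< = x<
    pick< false x< y< = y<

    oriented-edge : ∀ o {a b} x y → a ≡ pick o x y → b ≡ pick o y x → (a ≡ x × b ≡ y) ⊎ (a ≡ y × b ≡ x)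
    oriented-edge true x y e e' = inj₁ (e , e')
    oriented-edge false x y e e' = inj₂ (e , e')

    edge-orientation : ∀ o a u v x y → Step o a u v → (u ≡ x × v ≡ y) ⊎ (u ≡ y × v ≡ x) →
                       (x + a ≡[ mn ] y × u ≡ pick o x y) ⊎ (y + a ≡[ mn ] x × u ≡ pick o y x)
    edge-orientation true a u v .u .v st (inj₁ (refl , refl)) = inj₁ (st , refl)
    edge-orientation true a u v .v .u st (inj₂ (refl , refl)) = inj₂ (st , refl)
    edge-orientation false a u v .u .v st (inj₁ (refl , refl)) = inj₂ (sym st , refl)
    edge-orientation false a u v .v .u st (inj₂ (refl , refl)) = inj₁ (sym st , refl)

    HasEdge-sym : ∀ v x y → HasEdge m n v y x → HasEdge m n v x y
    HasEdge-sym v x y (j , j< , inj₁ e) = j , j< , inj₂ e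
    HasEdge-sym v x y (j , j< , inj₂ e) = j , j< , inj₁ e

    -- difference x y represents y - x in ℤ_mn.  It is *positive* when its
    -- residue modulo 2m lies strictly between 0 and m.
    difference : ℕ → ℕ → ℕ
    difference x y = (y + negate {mn} x) % mn

    difference-spec : ∀ x y → x + difference x y ≡[ mn ] y
    difference-spec x y = negate-cancel {mn} y x

    opposite-sum : ∀ x y a b → x + a ≡[ mn ] y → y + b ≡[ mn ] x → a + b ≡[ mn ] 0
    opposite-sum x y a b e e' = mod-cancelˡ {mn} x
      (trans (cong (_% mn) (sym (+-assoc x a b))) (trans (mod-+ʳ {mn} b e) (trans e' (cong (_% mn) (sym (+-identityʳ x))))))

    same-part : ∀ x y d → x + d ≡[ mn ] y → d ≡[ m ] 0 → x ≡[ m ] y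
    same-part x y d e d≡0 =
      trans (cong (_% m) (sym (+-identityʳ x))) (trans (mod-+ˡ {m} x (sym d≡0)) (mod-divisor m∣mn e))

    difference-crossing : ∀ x y → ¬ (x ≡[ m ] y) → ¬ (difference x y ≡[ m ] 0)
    difference-crossing x y x≢y d≡0 = x≢y (same-part x y _ (difference-spec x y) d≡0)

    residue≢0 : ∀ d → ¬ (d ≡[ m ] 0) → 0 < d % twoM
    residue≢0 d d≢0 = n≢0⇒n>0 λ r≡0 →
      d≢0 (trans (sym (m∣n⇒o%n%m≡o%m m twoM d m∣twoM)) (cong (_% m) r≡0))

    sum<twoM : ∀ a b → a < m → b < m → a + b < twoM
    sum<twoM a b a< b< = subst (a + b <_) (cong (m +_) (sym (+-identityʳ m))) (+-mono-< a< b<)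

    at-most-one-positive : ∀ d d' → 0 < d % twoM → d % twoM < m → d' % twoM < m → ¬ (d + d' ≡[ twoM ] 0)
    at-most-one-positive d d' pos small small' e = <-irrefl (sym sum≡0) (≤-trans pos (m≤m+n _ _))
      where
        open ≡-Reasoning
        sum≡0 : d % twoM + d' % twoM ≡ 0
        sum≡0 = begin
          d % twoM + d' % twoM           ≡⟨ sym (m<n⇒m%n≡m (sum<twoM _ _ small small')) ⟩
          (d % twoM + d' % twoM) % twoM ≡⟨ sym (%-distribˡ-+ d d' twoM) ⟩
          (d + d') % twoM                ≡⟨ e ⟩
          0 % twoM                       ≡⟨ 0%M {twoM} ⟩
          0                              ∎

    at-least-one-positive : ∀ d d' → ¬ (d ≡[ m ] 0) → d + d' ≡[ twoM ] 0 → d % twoM < m ⊎ d' % twoM < m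
    at-least-one-positive d d' d≢0 e with d % twoM <? m | d' % twoM <? m
    ... | yes small | _ = inj₁ small
    ... | no _ | yes small' = inj₂ small'
    ... | no large | no large' = ⊥-elim (d≢0 d≡0)
      where
        open ≡-Reasoning
        a : ℕ
        a = d % twoM ∸ m
        b : ℕ
        b = d' % twoM ∸ m
        upper : ∀ x → ¬ (x % twoM < m) → x % twoM ≡ m + (x % twoM ∸ m) × x % twoM ∸ m < m
        upper x large = sym (m+[n∸m]≡n (≮⇒≥ large)) ,
          +-cancelˡ-< m _ m (subst₂ _<_ (sym (m+[n∸m]≡n (≮⇒≥ large))) (cong (m +_) (+-identityʳ m)) (m%n<n x twoM))
        regroup : ∀ m a b → (m + a) + (m + b) ≡ (a + b) + 1 * (2 * m)
        regroup = solve-∀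
        a+b≡0 : a + b ≡ 0
        a+b≡0 = begin
          a + b                                ≡⟨ sym (rem-unique {twoM} 1 (a + b) (sum<twoM a b (proj₂ (upper d large)) (proj₂ (upper d' large')))) ⟩
          (a + b + 1 * twoM) % twoM            ≡⟨ cong (_% twoM) (sym (regroup m a b)) ⟩
          ((m + a) + (m + b)) % twoM           ≡⟨ cong₂ (λ u v → (u + v) % twoM) (sym (proj₁ (upper d large))) (sym (proj₁ (upper d' large'))) ⟩
          (d % twoM + d' % twoM) % twoM       ≡⟨ sym (%-distribˡ-+ d d' twoM) ⟩
          (d + d') % twoM                      ≡⟨ e ⟩
          0 % twoM                             ≡⟨ 0%M {twoM} ⟩
          0                                    ∎
        d≡0 : d ≡[ m ] 0
        d≡0 = begin
          d % m                ≡⟨ sym (m∣n⇒o%n%m≡o%m m twoM d m∣twoM) ⟩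
          d % twoM % m         ≡⟨ cong (_% m) (proj₁ (upper d large)) ⟩
          (m + a) % m          ≡⟨ cong (λ z → (m + z) % m) (m+n≡0⇒m≡0 a a+b≡0) ⟩
          (m + 0) % m          ≡⟨ cong (_% m) (+-identityʳ m) ⟩
          m % m                ≡⟨ n%n≡0 m ⟩
          0                    ≡⟨ sym (0%M {m}) ⟩
          0 % m                ∎

    reindex : ∀ (v w : ℕ → ℕ) s → (∀ a b → a ≡[ mn ] b → v a ≡ v b) → (∀ i → w i ≡ v (i + s)) → SameEdges m n w v
    reindex v w s v-cong rotated x y = forth , back
      where
        transport : ∀ {a b a' b' : ℕ} → a' ≡ a → b' ≡ b → (a ≡ x × b ≡ y) ⊎ (a ≡ y × b ≡ x) → (a' ≡ x × b' ≡ y) ⊎ (a' ≡ y × b' ≡ x)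
        transport refl refl e = e
        next : ∀ i k → k + s ≡[ mn ] i → suc k % mn + s ≡[ mn ] suc i % mn
        next i k e = trans (mod-+ʳ {mn} s (mod-reduce {mn} (suc k))) (trans (mod-+ˡ {mn} 1 e) (sym (mod-reduce {mn} (suc i))))
        forth : HasEdge m n w x y → HasEdge m n v x y
        forth (i , i< , e) = (i + s) % mn , m%n<n _ mn ,
          transport (trans (v-cong _ _ (mod-reduce {mn} (i + s))) (sym (rotated i)))
                    (trans (v-cong _ _ (sym (next ((i + s) % mn) i (sym (mod-reduce {mn} (i + s)))))) (sym (rotated (suc i % mn)))) e
        back : HasEdge m n v x y → HasEdge m n w x y
        back (i , i< , e) = i' , m%n<n _ mn , transport (trans (rotated i') (v-cong _ _ i'+s≡i)) (trans (rotated _) (v-cong _ _ (next i i' i'+s≡i))) e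
          where
            i' : ℕ
            i' = (i + negate {mn} s) % mn
            i'+s≡i : i' + s ≡[ mn ] i
            i'+s≡i = trans (cong (_% mn) (+-comm i' s)) (negate-cancel {mn} i s)

    -- Template t has period = suc (last t)
    -- dividing m and offsets offset t 0, …, offset t (last t), pairwise
    -- distinct modulo the period.  Position r of the template is a step by
    -- the difference diff t r = residue t r + level t r * 2m (forwards or
    -- backwards according to forward t r) to the next offset, the last
    -- position stepping to period + offset t 0.  The map (t , r) ↦
    -- (residue t r , level t r) is a bijection, with inverse decode, onto the
    -- pairs (ρ , u) with 0 < ρ < m and u < ℓ, i.e. onto the positive
    -- differences below mn.
    record Design : Set where
      field
        count : ℕ
        last : ℕ → ℕ
        offset : ℕ → ℕ → ℕ
        residue : ℕ → ℕ → ℕ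
        level : ℕ → ℕ → ℕ
        forward : ℕ → ℕ → Bool
        decode : ℕ → ℕ → ℕ × ℕ
        period∣m : ∀ t → t < count → suc (last t) ∣ m
        offset-injective : ∀ t r r' → t < count → r < suc (last t) → r' < suc (last t) →
                           offset t r % suc (last t) ≡ offset t r' % suc (last t) → r ≡ r'
        step : ∀ t r → t < count → suc r < suc (last t) →
               Step (forward t r) (residue t r + level t r * twoM) (offset t r) (offset t (suc r))
        wrap : ∀ t → t < count →
               Step (forward t (last t)) (residue t (last t) + level t (last t) * twoM)
                    (offset t (last t)) (suc (last t) + offset t 0)
        residue>0 : ∀ t r → t < count → r < suc (last t) → 0 < residue t r
        residue<m : ∀ t r → t < count → r < suc (last t) → residue t r < m
        level<ℓ : ∀ t r → t < count → r < suc (last t) → level t r < ℓ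
        decode-sound : ∀ ρ u → 0 < ρ → ρ < m → u < ℓ →
                       proj₁ (decode ρ u) < count × proj₂ (decode ρ u) < suc (last (proj₁ (decode ρ u))) ×
                       residue (proj₁ (decode ρ u)) (proj₂ (decode ρ u)) ≡ ρ ×
                       level (proj₁ (decode ρ u)) (proj₂ (decode ρ u)) ≡ u
        decode-inverse : ∀ t r → t < count → r < suc (last t) → decode (residue t r) (level t r) ≡ (t , r)

    module Build (D : Design) where
      open Design D

      period : ℕ → ℕ
      period t = suc (last t)

      diff : ℕ → ℕ → ℕ
      diff t r = residue t r + level t r * twoM

      period∣mn : ∀ t → t < count → period t ∣ mn
      period∣mn t t< = ∣-trans (period∣m t t<) m∣mn

      -- The closed walk developed from template t and translated by c: its
      -- j-th vertex is c + period · (j / period) + offset t (j % period).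
      vertex : ℕ → ℕ → ℕ → ℕ
      vertex t c j = (c + period t * (j / period t) + offset t (j % period t)) % mn

      vertex<mn : ∀ t c j → vertex t c j < mn
      vertex<mn t c j = m%n<n _ mn

      vertex-at : ∀ t c q r → r < period t → vertex t c (r + q * period t) ≡ (c + period t * q + offset t r) % mn
      vertex-at t c q r r< =
        cong₂ (λ a b → (c + period t * a + offset t b) % mn) (quot-unique {period t} q r r<) (rem-unique {period t} q r r<)

      vertex-shift : ∀ t c j k → vertex t c (j + k * period t) ≡ (vertex t c j + k * period t) % mn
      vertex-shift t c j k = begin
          (c + G * ((j + k * G) / G) + offset t ((j + k * G) % G)) % mn
            ≡⟨ cong₂ (λ a b → (c + G * a + offset t b) % mn) blocks position ⟩
          (c + G * (j / G + k) + offset t (j % G)) % mn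
            ≡⟨ cong (_% mn) (regroup c G (j / G) k (offset t (j % G))) ⟩
          (c + G * (j / G) + offset t (j % G) + k * G) % mn
            ≡⟨ mod-+ʳ {mn} (k * G) (sym (mod-reduce {mn} _)) ⟩
          (vertex t c j + k * G) % mn ∎
        where
          open ≡-Reasoning
          G : ℕ
          G = period t
          blocks : (j + k * G) / G ≡ j / G + k
          blocks = trans (+-distrib-/-∣ʳ j (n∣m*n k)) (cong (j / G +_) (m*n/n≡m k G))
          position : (j + k * G) % G ≡ j % G
          position = [m+kn]%n≡m%n j k G
          regroup : ∀ c G a k x → c + G * (a + k) + x ≡ c + G * a + x + k * G
          regroup = solve-∀

      vertex-periodic : ∀ t c a k → t < count → vertex t c (a + k * mn) ≡ vertex t c a
      vertex-periodic t c a k t< = begin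
          vertex t c (a + k * mn)            ≡⟨ cong (λ z → vertex t c (a + z)) blocks ⟩
          vertex t c (a + (k * L) * G)       ≡⟨ vertex-shift t c a (k * L) ⟩
          (vertex t c a + (k * L) * G) % mn  ≡⟨ cong (λ z → (vertex t c a + z) % mn) (sym blocks) ⟩
          (vertex t c a + k * mn) % mn       ≡⟨ add-multiple {mn} (vertex t c a) k ⟩
          vertex t c a % mn                  ≡⟨ m%n%n≡m%n _ mn ⟩
          vertex t c a                       ∎
        where
          open ≡-Reasoning
          G L : ℕ
          G = period t
          L = mn / G
          blocks : k * mn ≡ (k * L) * G
          blocks = trans (cong (k *_) (sym (m/n*n≡m (period∣mn t t<)))) (sym (*-assoc k L G))

      vertex-mod : ∀ t c a → t < count → vertex t c (a % mn) ≡ vertex t c a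
      vertex-mod t c a t< = sym (trans (cong (vertex t c) (divmod {mn} a)) (vertex-periodic t c (a % mn) (a / mn) t<))

      vertex-cong : ∀ t c → t < count → ∀ a b → a ≡[ mn ] b → vertex t c a ≡ vertex t c b
      vertex-cong t c t< a b e = trans (sym (vertex-mod t c a t<)) (trans (cong (vertex t c) e) (vertex-mod t c b t<))

      vertex-translate : ∀ t c k j → vertex t (c + k) j ≡ (vertex t c j + k) % mn
      vertex-translate t c k j = begin
          (c + k + G * q + x) % mn ≡⟨ cong (_% mn) (regroup c k (G * q) x) ⟩
          (c + G * q + x + k) % mn ≡⟨ mod-+ʳ {mn} k (sym (mod-reduce {mn} (c + G * q + x))) ⟩
          (vertex t c j + k) % mn  ∎
        where
          open ≡-Reasoning
          G q x : ℕ
          G = period t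
          q = j / G
          x = offset t (j % G)
          regroup : ∀ c k y x → c + k + y + x ≡ c + y + x + k
          regroup = solve-∀

      block-step : ∀ t c q r → t < count → r < period t →
                   Step (forward t r) (diff t r) (vertex t c (r + q * period t)) (vertex t c (suc r + q * period t))
      block-step t c q r t< r< with suc r <? period t
      ... | yes sr< = subst₂ (Step (forward t r) (diff t r)) (sym (vertex-at t c q r r<)) (sym (vertex-at t c q (suc r) sr<))
                        (develop (forward t r) (diff t r) (offset t r) (offset t (suc r)) (c + G * q) (step t r t< sr<))
        where
          G : ℕ
          G = period t
      ... | no sr≮ = subst₂ (Step (forward t r) (diff t r)) (sym (vertex-at t c q r r<)) (sym into-next-block)
                       (develop (forward t r) (diff t r) (offset t r) (G + offset t 0) (c + G * q) wrap-at-r)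
        where
          G : ℕ
          G = period t
          r≡last : r ≡ last t
          r≡last = ≤-antisym (≤-pred r<) (≤-pred (≮⇒≥ sr≮))
          wrap-at-r : Step (forward t r) (diff t r) (offset t r) (G + offset t 0)
          wrap-at-r = subst (λ z → Step (forward t z) (diff t z) (offset t z) (G + offset t 0)) (sym r≡last) (wrap t t<)
          regroup : ∀ c G q x → c + G * suc q + x ≡ c + G * q + (G + x)
          regroup = solve-∀
          into-next-block : vertex t c (suc r + q * G) ≡ (c + G * q + (G + offset t 0)) % mn
          into-next-block = begin
              vertex t c (suc r + q * G)            ≡⟨ cong (λ z → vertex t c (z + q * G)) (cong suc r≡last) ⟩
              vertex t c (0 + suc q * G)            ≡⟨ vertex-at t c (suc q) 0 (s≤s z≤n) ⟩
              (c + G * suc q + offset t 0) % mn     ≡⟨ cong (_% mn) (regroup c G q (offset t 0)) ⟩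
              (c + G * q + (G + offset t 0)) % mn   ∎
            where open ≡-Reasoning

      vertex-step : ∀ t c j → t < count →
                    Step (forward t (j % period t)) (diff t (j % period t)) (vertex t c j) (vertex t c (suc j % mn))
      vertex-step t c j t< =
        subst₂ (Step (forward t r) (diff t r)) (cong (vertex t c) (sym j≡)) (trans (cong (vertex t c) (cong suc (sym j≡))) (sym (vertex-mod t c (suc j) t<)))
          (block-step t c (j / period t) r t< (m%n<n j (period t)))
        where
          r : ℕ
          r = j % period t
          j≡ : j ≡ r + (j / period t) * period t
          j≡ = divmod {period t} j

      diff%twoM : ∀ t r → t < count → r < period t → diff t r % twoM ≡ residue t r
      diff%twoM t r t< r< = rem-unique {twoM} (level t r) (residue t r) (≤-trans (residue<m t r t< r<) (m≤m+n m (m + 0)))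

      diff/twoM : ∀ t r → t < count → r < period t → diff t r / twoM ≡ level t r
      diff/twoM t r t< r< = quot-unique {twoM} (level t r) (residue t r) (≤-trans (residue<m t r t< r<) (m≤m+n m (m + 0)))

      diff-positive : ∀ t r → t < count → r < period t → 0 < diff t r % twoM × diff t r % twoM < m
      diff-positive t r t< r< = subst (0 <_) (sym (diff%twoM t r t< r<)) (residue>0 t r t< r<) ,
                                subst (_< m) (sym (diff%twoM t r t< r<)) (residue<m t r t< r<)

      diff<mn : ∀ t r → t < count → r < period t → diff t r < mn
      diff<mn t r t< r< = begin-strict
          residue t r + level t r * twoM  <⟨ +-monoˡ-< (level t r * twoM) (≤-trans (residue<m t r t< r<) (m≤m+n m (m + 0))) ⟩
          suc (level t r) * twoM          ≤⟨ *-monoˡ-≤ twoM (level<ℓ t r t< r<) ⟩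
          ℓ * twoM                        ≡⟨ sym mn≡ℓ*twoM ⟩
          mn                              ∎
        where open ≤-Reasoning

      -- Since m ∣ 2m, a difference is never ≡ 0 (mod m): its residue is in (0, m).
      diff≢0 : ∀ t r → t < count → r < period t → ¬ (diff t r ≡[ m ] 0)
      diff≢0 t r t< r< d≡0 = <-irrefl (sym residue≡0) (residue>0 t r t< r<)
        where
          open ≡-Reasoning
          residue≡0 : residue t r ≡ 0
          residue≡0 = begin
            residue t r           ≡⟨ sym (m<n⇒m%n≡m (residue<m t r t< r<)) ⟩
            residue t r % m       ≡⟨ cong (_% m) (sym (diff%twoM t r t< r<)) ⟩
            diff t r % twoM % m   ≡⟨ m∣n⇒o%n%m≡o%m m twoM (diff t r) m∣twoM ⟩
            diff t r % m          ≡⟨ d≡0 ⟩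
            0 % m                 ≡⟨ 0%M {m} ⟩
            0                     ∎

      diff-injective : ∀ t r t' r' → t < count → r < period t → t' < count → r' < period t' →
                       diff t r ≡ diff t' r' → t ≡ t' × r ≡ r'
      diff-injective t r t' r' t< r< t'< r'< e = cong proj₁ same , cong proj₂ same
        where
          same : (t , r) ≡ (t' , r')
          same = trans (sym (decode-inverse t r t< r<))
                 (trans (cong₂ decode (trans (sym (diff%twoM t r t< r<)) (trans (cong (_% twoM) e) (diff%twoM t' r' t'< r'<)))
                                      (trans (sym (diff/twoM t r t< r<)) (trans (cong (_/ twoM) e) (diff/twoM t' r' t'< r'<))))
                 (decode-inverse t' r' t'< r'<))

      diff-surjective : ∀ d → d < mn → 0 < d % twoM → d % twoM < m →
                        Σ ℕ λ t → Σ ℕ λ r → t < count × r < period t × diff t r ≡ d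
      diff-surjective d d< pos small
        with decode (d % twoM) (d / twoM)
           | decode-sound (d % twoM) (d / twoM) pos small (m<n*o⇒m/o<n {d} {ℓ} {twoM} (subst (d <_) mn≡ℓ*twoM d<))
      ... | t , r | t< , r< , res , lev = t , r , t< , r< , trans (cong₂ (λ a b → a + b * twoM) res lev) (sym (divmod {twoM} d))

      -- Each walk is a hamiltonian cycle: modulo the period, vertex t c j
      -- remembers the position j % period t (offsets are distinct modulo the
      -- period), and position and vertex together recover j modulo mn.
      vertex-class : ∀ t c j → t < count → vertex t c j ≡[ period t ] c + offset t (j % period t)
      vertex-class t c j t< = begin
          vertex t c j % G                                   ≡⟨ mod-divisor (period∣mn t t<) (mod-reduce {mn} (c + G * (j / G) + x)) ⟩
          (c + G * (j / G) + x) % G                          ≡⟨ cong (_% G) (regroup c G (j / G) x) ⟩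
          (c + x + (j / G) * G) % G                          ≡⟨ add-multiple {G} (c + x) (j / G) ⟩
          (c + x) % G                                        ∎
        where
          open ≡-Reasoning
          G x : ℕ
          G = period t
          x = offset t (j % G)
          regroup : ∀ c G q x → c + G * q + x ≡ c + x + q * G
          regroup = solve-∀

      vertex-position : ∀ t c j → vertex t c j + j % period t ≡[ mn ] j + (c + offset t (j % period t))
      vertex-position t c j = begin
          (vertex t c j + r) % mn                   ≡⟨ mod-+ʳ {mn} r (mod-reduce {mn} (c + G * q + x)) ⟩
          (c + G * q + x + r) % mn                  ≡⟨ cong (_% mn) (regroup c G q x r) ⟩
          (r + q * G + (c + x)) % mn                ≡⟨ cong (λ z → (z + (c + x)) % mn) (sym (divmod {G} j)) ⟩
          (j + (c + x)) % mn                        ∎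
        where
          open ≡-Reasoning
          G q r x : ℕ
          G = period t
          q = j / G
          r = j % G
          x = offset t r
          regroup : ∀ c G q x r → c + G * q + x + r ≡ r + q * G + (c + x)
          regroup = solve-∀

      vertex-injective : ∀ t c i j → t < count → i < mn → j < mn → vertex t c i ≡ vertex t c j → i ≡ j
      vertex-injective t c i j t< i< j< e = mod-unique {mn} i< j< (mod-cancelʳ {mn} (c + offset t (i % G)) (begin
          (i + (c + offset t (i % G))) % mn   ≡⟨ sym (vertex-position t c i) ⟩
          (vertex t c i + i % G) % mn         ≡⟨ cong₂ (λ a b → (a + b) % mn) e same-position ⟩
          (vertex t c j + j % G) % mn         ≡⟨ vertex-position t c j ⟩
          (j + (c + offset t (j % G))) % mn   ≡⟨ cong (λ z → (j + (c + offset t z)) % mn) (sym same-position) ⟩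
          (j + (c + offset t (i % G))) % mn   ∎))
        where
          open ≡-Reasoning
          G : ℕ
          G = period t
          same-position : i % G ≡ j % G
          same-position = offset-injective t (i % G) (j % G) t< (m%n<n i G) (m%n<n j G)
            (mod-cancelˡ {G} c (trans (sym (vertex-class t c i t<)) (trans (cong (_% G) e) (vertex-class t c j t<))))

      hamCycle : ∀ t c → t < count → HamCycle m n
      hamCycle t c t< = record
        { vert = vertex t c
        ; inRange = λ i _ → vertex<mn t c i
        ; inj = λ i j i< j< → vertex-injective t c i j t< i< j<
        ; adj = λ j _ → vertex<mn t c j , vertex<mn t c (suc j % mn) ,
                  step-crosses-parts (forward t (j % period t)) (diff t (j % period t)) _ _ (vertex-step t c j t<)
                                     (diff≢0 t (j % period t) t< (m%n<n j (period t)))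
        }

      find-position : ∀ t r s → t < count → r < period t → s < mn →
                      Σ ℕ λ c → Σ ℕ λ j → c < period t × j < mn × j % period t ≡ r × vertex t c j ≡ s
      find-position t r s t< r< s< = c , j , m%n<n z G , j< , rem-unique {G} K r r< , found
        where
          G z c K j L : ℕ
          G = period t
          z = (s + negate {mn} (offset t r)) % mn      -- s - offset t r
          c = z % G
          K = z / G
          j = r + K * G
          L = mn / G
          L*G≡mn : L * G ≡ mn
          L*G≡mn = m/n*n≡m (period∣mn t t<)
          j< : j < mn
          j< = begin-strict
              r + K * G   <⟨ +-monoˡ-< (K * G) r< ⟩
              suc K * G   ≤⟨ *-monoˡ-≤ G (m<n*o⇒m/o<n {z} {L} {G} (subst (z <_) (sym L*G≡mn) (m%n<n _ mn))) ⟩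
              L * G       ≡⟨ L*G≡mn ⟩
              mn          ∎
            where open ≤-Reasoning
          found : vertex t c j ≡ s
          found = begin
              vertex t c j                    ≡⟨ vertex-at t c K r r< ⟩
              (c + G * K + offset t r) % mn   ≡⟨ cong (λ w → (w + offset t r) % mn) (trans (cong (c +_) (*-comm G K)) (sym (divmod {G} z))) ⟩
              (z + offset t r) % mn           ≡⟨ cong (_% mn) (+-comm z (offset t r)) ⟩
              (offset t r + z) % mn           ≡⟨ negate-cancel {mn} s (offset t r) ⟩
              s % mn                          ≡⟨ m<n⇒m%n≡m s< ⟩
              s                               ∎
            where open ≡-Reasoning

      edge-with-diff : ∀ t r x y → t < count → r < period t → x < mn → y < mn →
                       x + diff t r ≡[ mn ] y → Σ ℕ λ c → c < period t × HasEdge m n (vertex t c) x y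
      edge-with-diff t r x y t< r< x< y< e with find-position t r (pick (forward t r) x y) t< r< (pick< (forward t r) x< y<)
      ... | c , j , c< , j< , position , tail = c , c< , j , j< , oriented-edge o x y tail head
        where
          o : Bool
          o = forward t r
          along : Step o (diff t r) (pick o x y) (vertex t c (suc j % mn))
          along = subst₂ (λ z v → Step (forward t z) (diff t z) v (vertex t c (suc j % mn))) position tail (vertex-step t c j t<)
          head : vertex t c (suc j % mn) ≡ pick o y x
          head = mod-unique {mn} (vertex<mn t c (suc j % mn)) (pick< o y< x<)
                   (step-functional o (diff t r) (pick o x y) _ _ along (pick-step o (diff t r) x y e))

      positive-edge-covered : ∀ x y → x < mn → y < mn → ¬ (x ≡[ m ] y) → difference x y % twoM < m →
                              Σ ℕ λ t → Σ ℕ λ c → t < count × c < period t × HasEdge m n (vertex t c) x y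
      positive-edge-covered x y x< y< x≢y small =
        let (t , r , t< , r< , d≡) = diff-surjective (difference x y) (m%n<n _ mn) (residue≢0 _ (difference-crossing x y x≢y)) small
            (c , c< , e) = edge-with-diff t r x y t< r< x< y< (subst (λ a → x + a ≡[ mn ] y) (sym d≡) (difference-spec x y))
        in t , c , t< , c< , e

      edge-covered : ∀ x y → Adj m n x y → Σ ℕ λ t → Σ ℕ λ c → t < count × c < period t × HasEdge m n (vertex t c) x y
      edge-covered x y (x< , y< , x≢y) =
        by-sign (at-least-one-positive (difference x y) (difference y x) (difference-crossing x y x≢y)
                   (mod-divisor twoM∣mn (opposite-sum x y _ _ (difference-spec x y) (difference-spec y x))))
        where
          by-sign : difference x y % twoM < m ⊎ difference y x % twoM < m →
                    Σ ℕ λ t → Σ ℕ λ c → t < count × c < period t × HasEdge m n (vertex t c) x y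
          by-sign (inj₁ small) = positive-edge-covered x y x< y< x≢y small
          by-sign (inj₂ small) =
            let (t , c , t< , c< , e) = positive-edge-covered y x y< x< (x≢y ∘ sym) small
            in t , c , t< , c< , HasEdge-sym (vertex t c) x y e

      Traversal : ℕ → ℕ → ℕ → ℕ → ℕ → Set
      Traversal t c x y j =
        (x + diff t (j % period t) ≡[ mn ] y × vertex t c j ≡ pick (forward t (j % period t)) x y) ⊎
        (y + diff t (j % period t) ≡[ mn ] x × vertex t c j ≡ pick (forward t (j % period t)) y x)

      edge-data : ∀ t c x y → t < count → HasEdge m n (vertex t c) x y → Σ ℕ (Traversal t c x y)
      edge-data t c x y t< (j , _ , e) = j , edge-orientation _ _ _ _ x y (vertex-step t c j t<) e

      no-opposite : ∀ t r t' r' x y → t < count → r < period t → t' < count → r' < period t' →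
                    x + diff t r ≡[ mn ] y → y + diff t' r' ≡[ mn ] x → ⊥
      no-opposite t r t' r' x y t< r< t'< r'< e e' =
        at-most-one-positive (diff t r) (diff t' r') (proj₁ positive) (proj₂ positive) (proj₂ (diff-positive t' r' t'< r'<))
          (mod-divisor twoM∣mn (opposite-sum x y _ _ e e'))
        where
          positive : 0 < diff t r % twoM × diff t r % twoM < m
          positive = diff-positive t r t< r<

      same-shift : ∀ t c c' j j' → t < count → c < period t → c' < period t → j % period t ≡ j' % period t →
                   vertex t c j ≡ vertex t c' j' → c ≡ c'
      same-shift t c c' j j' t< c< c'< same e = mod-unique {G} c< c'< (mod-cancelʳ {G} {c} {c'} (offset t (j % G)) (begin
          (c + offset t (j % G)) % G     ≡⟨ sym (vertex-class t c j t<) ⟩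
          vertex t c j % G               ≡⟨ cong (_% G) e ⟩
          vertex t c' j' % G             ≡⟨ vertex-class t c' j' t< ⟩
          (c' + offset t (j' % G)) % G   ≡⟨ cong (λ z → (c' + offset t z) % G) (sym same) ⟩
          (c' + offset t (j % G)) % G    ∎))
        where
          open ≡-Reasoning
          G : ℕ
          G = period t

      -- ... so two walks traversing {x , y} in the same direction are equal:
      -- the difference fixes template and position class, the tail the translate.
      same-cycle : ∀ t c t' c' x y a j j' → t < count → c < period t → t' < count → c' < period t' →
                   x + diff t (j % period t) ≡[ mn ] y → x + diff t' (j' % period t') ≡[ mn ] y →
                   vertex t c j ≡ pick (forward t (j % period t)) x a →
                   vertex t' c' j' ≡ pick (forward t' (j' % period t')) x a → t ≡ t' × c ≡ c'
      same-cycle t c t' c' x y a j j' t< c< t'< c'< e e' v v' =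
        proj₁ same-position , conclude t' (proj₁ same-position) c' c'< (proj₂ same-position) v'
        where
          same-position : t ≡ t' × j % period t ≡ j' % period t'
          same-position = diff-injective t (j % period t) t' (j' % period t') t< (m%n<n j _) t'< (m%n<n j' _)
            (mod-unique {mn} (diff<mn t _ t< (m%n<n j _)) (diff<mn t' _ t'< (m%n<n j' _)) (mod-cancelˡ {mn} x (trans e (sym e'))))
          conclude : ∀ t' → t ≡ t' → ∀ c' → c' < period t' → j % period t ≡ j' % period t' →
                     vertex t' c' j' ≡ pick (forward t' (j' % period t')) x a → c ≡ c'
          conclude .t refl c' c'< same v' =
            same-shift t c c' j j' t< c< c'< same (trans v (trans (cong (λ z → pick (forward t z) x a) same) (sym v')))

      edge-unique : ∀ t c t' c' x y → t < count → c < period t → t' < count → c' < period t' →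
                    HasEdge m n (vertex t c) x y → HasEdge m n (vertex t' c') x y → t ≡ t' × c ≡ c'
      edge-unique t c t' c' x y t< c< t'< c'< h h' = by-direction (edge-data t c x y t< h) (edge-data t' c' x y t'< h')
        where
          by-direction : Σ ℕ (Traversal t c x y) → Σ ℕ (Traversal t' c' x y) → t ≡ t' × c ≡ c'
          by-direction (j , inj₁ (e , v)) (j' , inj₁ (e' , v')) = same-cycle t c t' c' x y y j j' t< c< t'< c'< e e' v v'
          by-direction (j , inj₂ (e , v)) (j' , inj₂ (e' , v')) = same-cycle t c t' c' y x x j j' t< c< t'< c'< e e' v v'
          by-direction (j , inj₁ (e , _)) (j' , inj₂ (e' , _)) = ⊥-elim (no-opposite t _ t' _ x y t< (m%n<n j _) t'< (m%n<n j' _) e e')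
          by-direction (j , inj₂ (e , _)) (j' , inj₁ (e' , _)) = ⊥-elim (no-opposite t _ t' _ y x t< (m%n<n j _) t'< (m%n<n j' _) e e')

      open Enumeration period
      open Indexed count

      cycleAt : Fin total → HamCycle m n
      cycleAt k = hamCycle (blockOf k) (entryOf k) (blockOf< k)

      at-index : ∀ t c (t< : t < count) (c< : c < period t) → vertex t c ≡ vert (cycleAt (index t c t< c<))
      at-index t c t< c< = sym (cong₂ vertex (proj₁ (of-index t c t< c<)) (proj₂ (of-index t c t< c<)))

      unique-cover : ∀ x y t c (t< : t < count) (c< : c < period t) → HasEdge m n (vertex t c) x y →
                     Σ (Fin total) λ k → HasEdge m n (vert (cycleAt k)) x y × (∀ k' → HasEdge m n (vert (cycleAt k')) x y → k' ≡ k)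
      unique-cover x y t c t< c< e = index t c t< c< , subst (λ v → HasEdge m n v x y) (at-index t c t< c<) e , unique
        where
          unique : ∀ k' → HasEdge m n (vert (cycleAt k')) x y → k' ≡ index t c t< c<
          unique k' e' = index-of k' t c t< c< (proj₁ same) (proj₂ same)
            where
              same : blockOf k' ≡ t × entryOf k' ≡ c
              same = edge-unique (blockOf k') (entryOf k') t c x y (blockOf< k') (entryOf< k') t< c< e' e

      system : HCS m n
      system = record
        { size = total
        ; cycle = cycleAt
        ; part = λ x y adj → let (t , c , t< , c< , e) = edge-covered x y adj in unique-cover x y t c t< c< e
        }

      translate-by-one : ∀ t c → t < count → SameEdges m n (shift m n 1 (vertex t c)) (vertex t (suc c))
      translate-by-one t c t< = reindex (vertex t (suc c)) (shift m n 1 (vertex t c)) 0 (vertex-cong t (suc c) t<)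
        λ i → trans (sym (vertex-translate t c 1 i)) (cong₂ (vertex t) (+-comm c 1) (sym (+-identityʳ i)))

      -- ... which for c + 1 = period t is walk (t , 0) rotated by one block.
      wrap-around : ∀ t c → t < count → suc c ≡ period t → SameEdges m n (shift m n 1 (vertex t c)) (vertex t 0)
      wrap-around t c t< c+1≡G = reindex (vertex t 0) (shift m n 1 (vertex t c)) (period t) (vertex-cong t 0 t<) rotated
        where
          open ≡-Reasoning
          rotated : ∀ i → (vertex t c i + 1) % mn ≡ vertex t 0 (i + period t)
          rotated i = begin
            (vertex t c i + 1) % mn              ≡⟨ sym (vertex-translate t c 1 i) ⟩
            vertex t (c + 1) i                   ≡⟨ cong (λ z → vertex t z i) (trans (+-comm c 1) c+1≡G) ⟩
            vertex t (0 + period t) i            ≡⟨ vertex-translate t 0 (period t) i ⟩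
            (vertex t 0 i + period t) % mn       ≡⟨ cong (λ z → (vertex t 0 i + z) % mn) (sym (*-identityˡ (period t))) ⟩
            (vertex t 0 i + 1 * period t) % mn   ≡⟨ sym (vertex-shift t 0 i 1) ⟩
            vertex t 0 (i + 1 * period t)        ≡⟨ cong (λ z → vertex t 0 (i + z)) (*-identityˡ (period t)) ⟩
            vertex t 0 (i + period t)            ∎

      cyclic-at : ∀ t c → t < count → c < period t → ∃ λ k → SameEdges m n (shift m n 1 (vertex t c)) (vert (cycleAt k))
      cyclic-at t c t< c< with suc c <? period t
      ... | yes c+1< = index t (suc c) t< c+1< , subst (SameEdges m n _) (at-index t (suc c) t< c+1<) (translate-by-one t c t<)
      ... | no c+1≮ = index t 0 t< (s≤s z≤n) ,
                      subst (SameEdges m n _) (at-index t 0 t< (s≤s z≤n)) (wrap-around t c t< (≤-antisym c< (≮⇒≥ c+1≮)))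

      cyclic : Cyclic m n system
      cyclic k = cyclic-at (blockOf k) (entryOf k) (blockOf< k) (entryOf< k)

      -- φ_n-symmetry: adding m = (m / period t) · period t advances each walk by m / period t blocks.
      phi-rotation : ∀ t c → t < count → SameEdges m n (shift m n m (vertex t c)) (vertex t c)
      phi-rotation t c t< = reindex (vertex t c) (shift m n m (vertex t c)) m (vertex-cong t c t<) rotated
        where
          K : ℕ
          K = m / period t
          K*G≡m : K * period t ≡ m
          K*G≡m = m/n*n≡m (period∣m t t<)
          rotated : ∀ i → (vertex t c i + m) % mn ≡ vertex t c (i + m)
          rotated i = trans (cong (λ z → (vertex t c i + z) % mn) (sym K*G≡m))
                        (trans (sym (vertex-shift t c i K)) (cong (λ z → vertex t c (i + z)) K*G≡m))

      phi-symmetric : PhiSymmetric m n system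
      phi-symmetric k = phi-rotation (blockOf k) (entryOf k) (blockOf< k)

      cyclicSystem : Σ (HCS m n) λ S → Cyclic m n S × PhiSymmetric m n S
      cyclicSystem = system , cyclic , phi-symmetric


-- The design for m = 2, n = 2ℓ with ℓ = 2b + 1 (so mn = 8b + 4).  The
-- positive differences are 1 + 4u (u < ℓ).  Template 0 has period 1 and
-- uses difference 1; template y + 1 (y < b) has period 2, offsets 0 and
-- 4y + 5, and uses 4y + 5 = 1 + 4(y + 1) followed by 1 + 4(2b - y), which
-- returns to 2 + 0 modulo mn.  The levels y + 1 and 2b - y (y < b) and 0
-- are exactly the levels below ℓ.
module SmallDesign (b : ℕ) where

  open import Defs
  open Congruence
  open Framework
  open import Data.Nat
  open import Data.Nat.Properties
  open import Data.Nat.DivMod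
  open import Data.Nat.Divisibility
  open import Data.Nat.Tactic.RingSolver
  open import Data.Product
  open import Data.Bool using (Bool; true)
  open import Relation.Nullary
  open import Relation.Binary.PropositionalEquality
  open import Data.Empty

  ℓ : ℕ
  ℓ = 1 + 2 * b

  m : ℕ
  m = 2

  open Frame m ℓ

  count : ℕ
  count = suc b

  last : ℕ → ℕ
  last zero = 0
  last (suc _) = 1

  offset : ℕ → ℕ → ℕ
  offset _ zero = 0
  offset zero (suc _) = 0
  offset (suc y) (suc _) = 4 * y + 5

  residue : ℕ → ℕ → ℕ
  residue _ _ = 1

  level : ℕ → ℕ → ℕ
  level zero _ = 0
  level (suc y) zero = suc y
  level (suc y) (suc _) = 2 * b ∸ y

  forward : ℕ → ℕ → Bool
  forward _ _ = true

  -- Levels 1 … b are first steps, levels b + 1 … 2b second steps.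
  decode : ℕ → ℕ → ℕ × ℕ
  decode _ zero = 0 , 0
  decode _ (suc u) with u <? b
  ... | yes _ = suc u , 0
  ... | no _ = suc (2 * b ∸ suc u) , 1

  period∣m : ∀ t → t < count → suc (last t) ∣ m
  period∣m zero _ = divides 2 refl
  period∣m (suc t) _ = divides 1 refl

  offset-odd : ∀ y → (4 * y + 5) % 2 ≡ 1
  offset-odd y = trans (cong (_% 2) (regroup y)) (rem-unique {2} (2 * y + 2) 1 (s≤s (s≤s z≤n)))
    where
      regroup : ∀ y → 4 * y + 5 ≡ 1 + (2 * y + 2) * 2
      regroup = solve-∀

  -- The two offsets of a period-2 template have different parities.
  offset-injective : ∀ t r r' → t < count → r < suc (last t) → r' < suc (last t) →
                     offset t r % suc (last t) ≡ offset t r' % suc (last t) → r ≡ r'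
  offset-injective zero zero zero _ _ _ _ = refl
  offset-injective (suc y) zero zero _ _ _ _ = refl
  offset-injective (suc y) (suc zero) (suc zero) _ _ _ _ = refl
  offset-injective (suc y) zero (suc zero) _ _ _ e = ⊥-elim (0≢1+n (trans e (offset-odd y)))
  offset-injective (suc y) (suc zero) zero _ _ _ e = ⊥-elim (0≢1+n (trans (sym e) (offset-odd y)))
  offset-injective zero (suc r) _ _ (s≤s ()) _ _
  offset-injective zero zero (suc r') _ _ (s≤s ()) _
  offset-injective (suc y) (suc (suc r)) _ _ (s≤s (s≤s ())) _ _
  offset-injective (suc y) _ (suc (suc r)) _ _ (s≤s (s≤s ())) _

  b≤2b : b ≤ 2 * b
  b≤2b = m≤m+n b (b + 0)

  step : ∀ t r → t < count → suc r < suc (last t) →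
         Step (forward t r) (residue t r + level t r * twoM) (offset t r) (offset t (suc r))
  step zero r _ (s≤s ())
  step (suc y) zero _ _ = cong (_% mn) (regroup y)
    where
      regroup : ∀ y → 0 + (1 + suc y * 4) ≡ 4 * y + 5
      regroup = solve-∀
  step (suc y) (suc r) _ (s≤s (s≤s ()))

  -- 4y + 5 + (1 + 4(2b - y)) = 2 + mn.
  wrap : ∀ t → t < count →
         Step (forward t (last t)) (residue t (last t) + level t (last t) * twoM) (offset t (last t)) (suc (last t) + offset t 0)
  wrap zero _ = refl
  wrap (suc y) (s≤s y<b) = trans (cong (_% mn) sum≡) (add-multiple {mn} 2 1)
    where
      k : ℕ
      k = 2 * b ∸ y
      y+k≡2b : y + k ≡ 2 * b
      y+k≡2b = m+[n∸m]≡n (≤-trans (<⇒≤ y<b) b≤2b)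
      regroup : ∀ y k → 4 * y + 5 + (1 + k * 4) ≡ 2 + 1 * (2 * (2 * (1 + (y + k))))
      regroup = solve-∀
      sum≡ : 4 * y + 5 + (1 + k * 4) ≡ 2 + 1 * mn
      sum≡ = trans (regroup y k) (cong (λ z → 2 + 1 * (2 * (2 * (1 + z)))) y+k≡2b)

  residue>0 : ∀ t r → t < count → r < suc (last t) → 0 < residue t r
  residue>0 _ _ _ _ = s≤s z≤n

  residue<m : ∀ t r → t < count → r < suc (last t) → residue t r < m
  residue<m _ _ _ _ = s≤s (s≤s z≤n)

  level<ℓ : ∀ t r → t < count → r < suc (last t) → level t r < ℓ
  level<ℓ zero _ _ _ = s≤s z≤n
  level<ℓ (suc y) zero (s≤s y<b) _ = s≤s (≤-trans y<b b≤2b)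
  level<ℓ (suc y) (suc r) _ _ = s≤s (m∸n≤m (2 * b) y)

  decode-sound : ∀ ρ u → 0 < ρ → ρ < m → u < ℓ →
                 proj₁ (decode ρ u) < count × proj₂ (decode ρ u) < suc (last (proj₁ (decode ρ u))) ×
                 residue (proj₁ (decode ρ u)) (proj₂ (decode ρ u)) ≡ ρ × level (proj₁ (decode ρ u)) (proj₂ (decode ρ u)) ≡ u
  decode-sound (suc (suc ρ)) u _ (s≤s (s≤s ())) _
  decode-sound 1 zero _ _ _ = s≤s z≤n , s≤s z≤n , refl , refl
  decode-sound 1 (suc u) _ _ (s≤s u<2b) with u <? b
  ... | yes u<b = s≤s u<b , s≤s z≤n , refl , refl
  ... | no u≮b = s≤s k<b , s≤s (s≤s z≤n) , refl , m∸[m∸n]≡n u<2b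
    where
      -- k = 2b - (u + 1) < b because u ≥ b
      k : ℕ
      k = 2 * b ∸ suc u
      k<b : k < b
      k<b = +-cancelˡ-≤ u (suc k) b (subst (_≤ u + b) (sym (+-suc u k))
              (subst (_≤ u + b) (sym (m+[n∸m]≡n u<2b)) (subst (_≤ u + b) (cong (b +_) (sym (+-identityʳ b))) (+-monoˡ-≤ b (≮⇒≥ u≮b)))))

  decode-inverse : ∀ t r → t < count → r < suc (last t) → decode (residue t r) (level t r) ≡ (t , r)
  decode-inverse zero zero _ _ = refl
  decode-inverse zero (suc r) _ (s≤s ())
  decode-inverse (suc y) zero (s≤s y<b) _ with y <? b
  ... | yes _ = refl
  ... | no y≮b = ⊥-elim (y≮b y<b)
  decode-inverse (suc y) (suc (suc r)) _ (s≤s (s≤s ()))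
  decode-inverse (suc y) (suc zero) (s≤s y<b) _ = trans (cong (decode 1) level≡) (second-step b≤u)
    where
      -- level 2b - y is suc u with u = 2b - (y + 1) ≥ b
      u : ℕ
      u = 2 * b ∸ suc y
      y<2b : suc y ≤ 2 * b
      y<2b = ≤-trans y<b b≤2b
      level≡ : 2 * b ∸ y ≡ suc u
      level≡ = trans (cong (_∸ y) (sym (trans (+-suc y u) (m+[n∸m]≡n y<2b)))) (m+n∸m≡n y (suc u))
      b≤u : b ≤ u
      b≤u = subst (_≤ u) (trans (cong (_∸ b) (cong (b +_) (+-identityʳ b))) (m+n∸m≡n b b)) (∸-monoʳ-≤ (2 * b) y<b)
      second-step : b ≤ u → decode 1 (suc u) ≡ (suc y , 1)
      second-step b≤u with u <? b
      ... | yes u<b = ⊥-elim (<-irrefl refl (<-≤-trans u<b b≤u))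
      ... | no _ = cong (λ z → suc z , 1) (trans (cong (2 * b ∸_) (sym level≡)) (m∸[m∸n]≡n (<⇒≤ y<2b)))

  design : Design
  design = record
    { count = count ; last = last ; offset = offset ; residue = residue ; level = level ; forward = forward
    ; decode = decode ; period∣m = period∣m ; offset-injective = offset-injective ; step = step ; wrap = wrap
    ; residue>0 = residue>0 ; residue<m = residue<m ; level<ℓ = level<ℓ
    ; decode-sound = decode-sound ; decode-inverse = decode-inverse }

  cyclicSystem : Σ (HCS m n) λ S → Cyclic m n S × PhiSymmetric m n S
  cyclicSystem = Build.cyclicSystem design


-- The design for m = 2h with h = 2a + 3 and n = 2ℓ with ℓ = 2b + 1, so that
-- 2m = 4h and mn = 4hℓ; the positive differences are ρ + 4h·u with
-- 0 < ρ < 2h and u < ℓ.  Templates t < ℓ are Z-templates, templates ℓ + s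
-- (s < ℓ·W, W = a + 1) are P-templates.
--
-- Z-template i has period h.  An even position r < h - 1 has offset r, an
-- odd one offset -(4h·i + r + 1), and the last position h - 1 the offset
-- (h - 1) + 4h·(4b - 2i + 1).  Position r < h - 1 steps by residue
-- 2(r + 1) at level i (level 2b - i at r = h - 2), backwards from even and
-- forwards from odd positions; the last position steps forwards by residue
-- 1 at level levelLast i = 2i + 1 mod ℓ.  The Z-templates thus use every
-- even residue and residue 1, each at every level.
--
-- P-template s = q·W + w (w < W) has period 2, offsets 0 and
-- 4h·q + 4w + 5, and steps forwards by residue 4w + 5 and backwards by
-- residue 4w + 3, both at level q: every odd residue from 3 to 2h - 1 at
-- every level.
module LargeDesign (a b : ℕ) where

  open import Defs
  open Congruence
  open Framework
  open Parity
  open import Data.Nat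
  open import Data.Nat.Properties
  open import Data.Nat.DivMod
  open import Data.Nat.Divisibility
  open import Data.Nat.Tactic.RingSolver
  open import Data.Product
  open import Data.Sum
  open import Data.Bool using (Bool; true; false; not)
  open import Relation.Nullary
  open import Relation.Binary.PropositionalEquality
  open import Data.Empty
  open import Function using (_∘_)

  dec≡ : ∀ x y → (x ≡ y) ⊎ (x ≢ y)
  dec≡ x y with x ≟ y
  ... | yes e = inj₁ e
  ... | no ne = inj₂ ne

  h : ℕ
  h = 3 + 2 * a

  ℓ : ℕ
  ℓ = 1 + 2 * b

  m : ℕ
  m = 2 * h

  open Frame m ℓ

  -- the last and the penultimate position of a Z-template: h - 1 and h - 2
  lastZ : ℕ
  lastZ = 2 + 2 * a

  penultZ : ℕ
  penultZ = 1 + 2 * a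

  W : ℕ
  W = 1 + a

  minus : ℕ → ℕ
  minus x = mn ∸ x

  levelLast : ℕ → ℕ
  levelLast i with suc (2 * i) <? ℓ
  ... | yes _ = suc (2 * i)
  ... | no _ = suc (2 * i) ∸ ℓ

  lastOffsetZ : ℕ → ℕ
  lastOffsetZ i = lastZ + twoM * (2 * (2 * b ∸ i) + 1)

  offsetZ : ℕ → ℕ → ℕ
  offsetZ i r with r ≟ lastZ | odd r
  ... | yes _ | _ = lastOffsetZ i
  ... | no _ | true = minus (twoM * i + suc r)
  ... | no _ | false = r

  residueZ : ℕ → ℕ
  residueZ r with r ≟ lastZ
  ... | yes _ = 1
  ... | no _ = 2 * suc r

  levelZ : ℕ → ℕ → ℕ
  levelZ i r with r ≟ lastZ | r ≟ penultZ
  ... | yes _ | _ = levelLast i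
  ... | no _ | yes _ = 2 * b ∸ i
  ... | no _ | no _ = i

  forwardZ : ℕ → Bool
  forwardZ r with r ≟ lastZ
  ... | yes _ = true
  ... | no _ = odd r

  levelP : ℕ → ℕ
  levelP s = s / W

  columnP : ℕ → ℕ
  columnP s = s % W

  offsetP : ℕ → ℕ → ℕ
  offsetP s zero = 0
  offsetP s (suc _) = twoM * levelP s + 4 * columnP s + 5

  residueP : ℕ → ℕ → ℕ
  residueP s zero = 4 * columnP s + 5
  residueP s (suc _) = 4 * columnP s + 3

  forwardP : ℕ → Bool
  forwardP zero = true
  forwardP (suc _) = false

  select : {X : Set} → ℕ → (ℕ → X) → (ℕ → X) → X
  select t f g with t <? ℓ
  ... | yes _ = f t
  ... | no _ = g (t ∸ ℓ)

  select-Z : {X : Set} → ∀ t (f g : ℕ → X) → t < ℓ → select t f g ≡ f t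
  select-Z t f g t<ℓ with t <? ℓ
  ... | yes _ = refl
  ... | no t≮ℓ = ⊥-elim (t≮ℓ t<ℓ)

  select-P : {X : Set} → ∀ t (f g : ℕ → X) → ¬ t < ℓ → select t f g ≡ g (t ∸ ℓ)
  select-P t f g t≮ℓ with t <? ℓ
  ... | yes t<ℓ = ⊥-elim (t≮ℓ t<ℓ)
  ... | no _ = refl

  count : ℕ
  count = ℓ + ℓ * W

  last : ℕ → ℕ
  last t = select t (λ _ → lastZ) (λ _ → 1)

  offset : ℕ → ℕ → ℕ
  offset t r = select t (λ i → offsetZ i r) (λ s → offsetP s r)

  residue : ℕ → ℕ → ℕ
  residue t r = select t (λ _ → residueZ r) (λ s → residueP s r)

  level : ℕ → ℕ → ℕ
  level t r = select t (λ i → levelZ i r) (λ s → levelP s)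

  forward : ℕ → ℕ → Bool
  forward t r = select t (λ _ → forwardZ r) (λ _ → forwardP r)

  -- Decoding a pair (ρ , u), by the parity of ρ = p + k·2: an even residue
  -- 2(r + 1) is position r of Z-template u (or position h - 2 of Z-template
  -- 2b - u), residue 1 is the last position of Z-template levelLast⁻¹ u, and
  -- residue 1 + (1 + w·2 + p′)·2 is position 1 - p′ of P-template u·W + w.
  levelLast⁻¹-by-parity : ℕ → ℕ → ℕ
  levelLast⁻¹-by-parity zero k = k + b
  levelLast⁻¹-by-parity (suc _) k = k

  levelLast⁻¹ : ℕ → ℕ
  levelLast⁻¹ u = levelLast⁻¹-by-parity (u % 2) (u / 2)

  decodeEven : ℕ → ℕ → ℕ × ℕ
  decodeEven zero u = 0 , 0
  decodeEven (suc r) u with r ≟ penultZ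
  ... | yes _ = 2 * b ∸ u , penultZ
  ... | no _ = u , r

  decodeOdd-by-parity : ℕ → ℕ → ℕ → ℕ × ℕ
  decodeOdd-by-parity zero w u = ℓ + u * W + w , 1
  decodeOdd-by-parity (suc _) w u = ℓ + u * W + w , 0

  decodeOdd : ℕ → ℕ → ℕ × ℕ
  decodeOdd zero u = levelLast⁻¹ u , lastZ
  decodeOdd (suc k) u = decodeOdd-by-parity (k % 2) (k / 2) u

  decode-by-parity : ℕ → ℕ → ℕ → ℕ × ℕ
  decode-by-parity zero k u = decodeEven k u
  decode-by-parity (suc _) k u = decodeOdd k u

  decode : ℕ → ℕ → ℕ × ℕ
  decode ρ u = decode-by-parity (ρ % 2) (ρ / 2) u

  offsetZ-last : ∀ i → offsetZ i lastZ ≡ lastOffsetZ i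
  offsetZ-last i with lastZ ≟ lastZ | odd lastZ
  ... | yes _ | _ = refl
  ... | no ne | _ = ⊥-elim (ne refl)

  offsetZ-odd : ∀ i r → r ≢ lastZ → odd r ≡ true → offsetZ i r ≡ minus (twoM * i + suc r)
  offsetZ-odd i r ne o with r ≟ lastZ | odd r
  offsetZ-odd i r ne o | yes e | _ = ⊥-elim (ne e)
  offsetZ-odd i r ne o | no _ | true = refl
  offsetZ-odd i r ne () | no _ | false

  offsetZ-even : ∀ i r → r ≢ lastZ → odd r ≡ false → offsetZ i r ≡ r
  offsetZ-even i r ne o with r ≟ lastZ | odd r
  offsetZ-even i r ne o | yes e | _ = ⊥-elim (ne e)
  offsetZ-even i r ne () | no _ | true
  offsetZ-even i r ne o | no _ | false = refl

  residueZ-last : residueZ lastZ ≡ 1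
  residueZ-last with lastZ ≟ lastZ
  ... | yes _ = refl
  ... | no ne = ⊥-elim (ne refl)

  residueZ-other : ∀ r → r ≢ lastZ → residueZ r ≡ 2 * suc r
  residueZ-other r ne with r ≟ lastZ
  ... | yes e = ⊥-elim (ne e)
  ... | no _ = refl

  penultZ≢lastZ : penultZ ≢ lastZ
  penultZ≢lastZ e = <-irrefl e (n<1+n penultZ)

  levelZ-last : ∀ i → levelZ i lastZ ≡ levelLast i
  levelZ-last i with lastZ ≟ lastZ | lastZ ≟ penultZ
  ... | yes _ | _ = refl
  ... | no ne | _ = ⊥-elim (ne refl)

  levelZ-penult : ∀ i → levelZ i penultZ ≡ 2 * b ∸ i
  levelZ-penult i with penultZ ≟ lastZ | penultZ ≟ penultZ
  ... | yes e | _ = ⊥-elim (penultZ≢lastZ e)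
  ... | no _ | yes _ = refl
  ... | no _ | no ne = ⊥-elim (ne refl)

  levelZ-other : ∀ i r → r ≢ lastZ → r ≢ penultZ → levelZ i r ≡ i
  levelZ-other i r n1 n2 with r ≟ lastZ | r ≟ penultZ
  ... | yes e | _ = ⊥-elim (n1 e)
  ... | no _ | yes e = ⊥-elim (n2 e)
  ... | no _ | no _ = refl

  forwardZ-last : forwardZ lastZ ≡ true
  forwardZ-last with lastZ ≟ lastZ
  ... | yes _ = refl
  ... | no ne = ⊥-elim (ne refl)

  forwardZ-other : ∀ r → r ≢ lastZ → forwardZ r ≡ odd r
  forwardZ-other r ne with r ≟ lastZ
  ... | yes e = ⊥-elim (ne e)
  ... | no _ = refl

  lastZ-even : lastZ ≡ W * 2
  lastZ-even = regroup a
    where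
      regroup : ∀ a → 2 + 2 * a ≡ (1 + a) * 2
      regroup = solve-∀

  penultZ-odd : penultZ ≡ 1 + a * 2
  penultZ-odd = cong suc (*-comm 2 a)

  odd-lastZ : odd lastZ ≡ false
  odd-lastZ = trans (cong odd lastZ-even) (odd-even W)

  odd-penultZ : odd penultZ ≡ true
  odd-penultZ = trans (cong odd penultZ-odd) (odd-odd a)

  last-Z : ∀ t → t < ℓ → last t ≡ lastZ
  last-Z t = select-Z t _ _
  last-P : ∀ t → ¬ t < ℓ → last t ≡ 1
  last-P t = select-P t _ _
  offset-Z : ∀ t r → t < ℓ → offset t r ≡ offsetZ t r
  offset-Z t r = select-Z t _ _
  offset-P : ∀ t r → ¬ t < ℓ → offset t r ≡ offsetP (t ∸ ℓ) r
  offset-P t r = select-P t _ _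
  residue-Z : ∀ t r → t < ℓ → residue t r ≡ residueZ r
  residue-Z t r = select-Z t _ _
  residue-P : ∀ t r → ¬ t < ℓ → residue t r ≡ residueP (t ∸ ℓ) r
  residue-P t r = select-P t _ _
  level-Z : ∀ t r → t < ℓ → level t r ≡ levelZ t r
  level-Z t r = select-Z t _ _
  level-P : ∀ t r → ¬ t < ℓ → level t r ≡ levelP (t ∸ ℓ)
  level-P t r = select-P t _ _
  forward-Z : ∀ t r → t < ℓ → forward t r ≡ forwardZ r
  forward-Z t r = select-Z t _ _
  forward-P : ∀ t r → ¬ t < ℓ → forward t r ≡ forwardP r
  forward-P t r = select-P t _ _

  period∣m : ∀ t → t < count → suc (last t) ∣ m
  period∣m t _ with <-≤-connex t ℓ
  ... | inj₁ t<ℓ = subst (λ z → suc z ∣ m) (sym (last-Z t t<ℓ)) (divides 2 refl)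
  ... | inj₂ ℓ≤t = subst (λ z → suc z ∣ m) (sym (last-P t (≤⇒≯ ℓ≤t))) (divides h (*-comm 2 h))

  -- Offsets of Z-templates modulo h.  Multiples of 2m = 4h vanish modulo h ...
  mn≡4ℓ*h : mn ≡ (4 * ℓ) * h
  mn≡4ℓ*h = regroup h ℓ
    where
      regroup : ∀ h ℓ → (2 * h) * (2 * ℓ) ≡ (4 * ℓ) * h
      regroup = solve-∀

  twoM*≡ : ∀ X → twoM * X ≡ (4 * X) * h
  twoM*≡ X = regroup h X
    where
      regroup : ∀ h X → 2 * (2 * h) * X ≡ (4 * X) * h
      regroup = solve-∀

  h≤twoM : h ≤ twoM
  h≤twoM = ≤-trans (m≤m+n h (h + 0)) (m≤m+n (2 * h) (2 * h + 0))

  below-mn : ∀ i r → i < ℓ → r < h → twoM * i + suc r ≤ mn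
  below-mn i r i<ℓ r<h = begin
      twoM * i + suc r ≤⟨ +-monoʳ-≤ (twoM * i) (≤-trans r<h h≤twoM) ⟩
      twoM * i + twoM ≡⟨ +-comm (twoM * i) twoM ⟩
      twoM + twoM * i ≡⟨ sym (*-suc twoM i) ⟩
      twoM * suc i ≤⟨ *-monoʳ-≤ twoM i<ℓ ⟩
      twoM * ℓ ≡⟨ *-comm twoM ℓ ⟩
      ℓ * twoM ≡⟨ sym mn≡ℓ*twoM ⟩
      mn ∎
    where open ≤-Reasoning

  -- ... so -(4h·i + r + 1) ≡ -(r + 1) ≡ h - 1 - r (mod h).
  minus-mod-h : ∀ i r → i < ℓ → r < lastZ → minus (twoM * i + suc r) % h ≡ lastZ ∸ r
  minus-mod-h i r i<ℓ r<last = trans y≡ (m<n⇒m%n≡m (s≤s (m∸n≤m lastZ r)))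
    where
      open ≡-Reasoning
      x y : ℕ
      x = twoM * i + suc r
      y = minus x
      y+r+1≡y+x : y + suc r ≡[ h ] y + x
      y+r+1≡y+x = mod-+ˡ {h} y (sym (begin
        (twoM * i + suc r) % h      ≡⟨ cong (λ z → (z + suc r) % h) (twoM*≡ i) ⟩
        ((4 * i) * h + suc r) % h   ≡⟨ cong (_% h) (+-comm ((4 * i) * h) (suc r)) ⟩
        (suc r + (4 * i) * h) % h   ≡⟨ add-multiple {h} (suc r) (4 * i) ⟩
        suc r % h                   ∎))
      h≡ : (lastZ ∸ r) + suc r ≡ h
      h≡ = trans (+-suc (lastZ ∸ r) r) (cong suc (m∸n+n≡m (<⇒≤ r<last)))
      y≡ : y % h ≡ (lastZ ∸ r) % h
      y≡ = mod-cancelʳ {h} {y} {lastZ ∸ r} (suc r) (begin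
        (y + suc r) % h             ≡⟨ y+r+1≡y+x ⟩
        (y + x) % h                 ≡⟨ cong (_% h) (m∸n+n≡m (below-mn i r i<ℓ (≤-trans r<last (n≤1+n lastZ)))) ⟩
        mn % h                      ≡⟨ cong (_% h) mn≡4ℓ*h ⟩
        ((4 * ℓ) * h) % h           ≡⟨ multiple≡0 {h} (4 * ℓ) ⟩
        0 % h                       ≡⟨ sym (n%n≡0 h) ⟩
        h % h                       ≡⟨ cong (_% h) (sym h≡) ⟩
        ((lastZ ∸ r) + suc r) % h   ∎)

  offsetZ-mod-h : ∀ i r → i < ℓ → r < h →
         (odd r ≡ false × offsetZ i r % h ≡ r) ⊎ (odd r ≡ true × offsetZ i r % h ≡ lastZ ∸ r × r < lastZ)
  offsetZ-mod-h i r i<ℓ r<h with dec≡ r lastZ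
  ... | inj₁ refl = inj₁ (odd-lastZ , trans (cong (_% h) (offsetZ-last i))
                     (trans (cong (λ z → (lastZ + z) % h) (twoM*≡ X)) (rem-unique {h} (4 * X) lastZ (n<1+n lastZ))))
    where X = 2 * (2 * b ∸ i) + 1
  ... | inj₂ ne with parity-view r
  ...   | inj₁ (_ , _ , even) = inj₁ (even , trans (cong (_% h) (offsetZ-even i r ne even)) (m<n⇒m%n≡m r<h))
  ...   | inj₂ (_ , _ , odd-r) = inj₂ (odd-r , trans (cong (_% h) (offsetZ-odd i r ne odd-r)) (minus-mod-h i r i<ℓ r<last) , r<last)
    where
      r<last : r < lastZ
      r<last = ≤∧≢⇒< (≤-pred r<h) ne

  -- An even r never equals h - 1 - r' for odd r' (h - 1 is even).
  parity-clash : ∀ r r' → odd r ≡ false → odd r' ≡ true → r ≡ lastZ ∸ r' → r' < lastZ → ⊥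
  parity-clash r r' even odd-r' r≡ r'<last with parity-view r | parity-view r'
  ... | inj₂ (_ , _ , odd-r) | _ = false≢true (trans (sym even) odd-r)
  ... | _ | inj₁ (_ , _ , even') = false≢true (trans (sym even') odd-r')
  ... | inj₁ (k , r≡k*2 , _) | inj₂ (k' , r'≡ , _) = even≢odd′ W (k + k') (sym (begin
        1 + (k + k') * 2           ≡⟨ regroup k k' ⟩
        k * 2 + (1 + k' * 2)       ≡⟨ cong₂ _+_ (sym r≡k*2) (sym r'≡) ⟩
        r + r'                     ≡⟨ cong (_+ r') r≡ ⟩
        lastZ ∸ r' + r'            ≡⟨ m∸n+n≡m (<⇒≤ r'<last) ⟩
        lastZ                      ≡⟨ lastZ-even ⟩
        W * 2                      ∎))
    where
      open ≡-Reasoning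
      regroup : ∀ k k' → 1 + (k + k') * 2 ≡ k * 2 + (1 + k' * 2)
      regroup = solve-∀

  offsetZ-injective : ∀ i r r' → i < ℓ → r < h → r' < h → offsetZ i r % h ≡ offsetZ i r' % h → r ≡ r'
  offsetZ-injective i r r' i<ℓ r<h r'<h e with offsetZ-mod-h i r i<ℓ r<h | offsetZ-mod-h i r' i<ℓ r'<h
  ... | inj₁ (_ , v) | inj₁ (_ , v') = trans (sym v) (trans e v')
  ... | inj₂ (_ , v , l) | inj₂ (_ , v' , l') =
        trans (sym (m∸[m∸n]≡n (<⇒≤ l))) (trans (cong (lastZ ∸_) (trans (sym v) (trans e v'))) (m∸[m∸n]≡n (<⇒≤ l')))
  ... | inj₁ (even , v) | inj₂ (odd-r' , v' , l') = ⊥-elim (parity-clash r r' even odd-r' (trans (sym v) (trans e v')) l')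
  ... | inj₂ (odd-r , v , l) | inj₁ (even' , v') = ⊥-elim (parity-clash r' r even' odd-r (trans (sym v') (trans (sym e) v)) l)

  -- The two offsets of a P-template have different parities.
  offsetP-odd : ∀ s → offsetP s 1 % 2 ≡ 1
  offsetP-odd s = trans (cong (_% 2) (regroup (levelP s) (columnP s) h)) (rem-unique {2} (2 * h * levelP s + 2 * columnP s + 2) 1 (s≤s (s≤s z≤n)))
    where
      regroup : ∀ q w h → 2 * (2 * h) * q + 4 * w + 5 ≡ 1 + (2 * h * q + 2 * w + 2) * 2
      regroup = solve-∀

  offsetP-injective : ∀ s r r' → r < 2 → r' < 2 → offsetP s r % 2 ≡ offsetP s r' % 2 → r ≡ r'
  offsetP-injective s zero zero _ _ _ = refl
  offsetP-injective s (suc zero) (suc zero) _ _ _ = refl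
  offsetP-injective s (suc (suc _)) _ (s≤s (s≤s ())) _ _
  offsetP-injective s _ (suc (suc _)) _ (s≤s (s≤s ())) _
  offsetP-injective s zero (suc zero) _ _ e = ⊥-elim (0≢1+n (trans e (offsetP-odd s)))
  offsetP-injective s (suc zero) zero _ _ e = ⊥-elim (0≢1+n (trans (sym e) (offsetP-odd s)))

  offset-injective : ∀ t r r' → t < count → r < suc (last t) → r' < suc (last t) →
         offset t r % suc (last t) ≡ offset t r' % suc (last t) → r ≡ r'
  offset-injective t r r' _ r< r'< e with <-≤-connex t ℓ
  ... | inj₁ t<ℓ = offsetZ-injective t r r' t<ℓ (subst (λ z → r < suc z) (last-Z t t<ℓ) r<) (subst (λ z → r' < suc z) (last-Z t t<ℓ) r'<)
                     (subst₂ (λ z w → z % suc w ≡ offsetZ t r' % suc w) (offset-Z t r t<ℓ) (last-Z t t<ℓ)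
                       (subst (λ z → offset t r % suc (last t) ≡ z % suc (last t)) (offset-Z t r' t<ℓ) e))
  ... | inj₂ ℓ≤t = offsetP-injective (t ∸ ℓ) r r' (subst (λ z → r < suc z) (last-P t t≮ℓ) r<) (subst (λ z → r' < suc z) (last-P t t≮ℓ) r'<)
                     (subst₂ (λ z w → z % suc w ≡ offsetP (t ∸ ℓ) r' % suc w) (offset-P t r t≮ℓ) (last-P t t≮ℓ)
                       (subst (λ z → offset t r % suc (last t) ≡ z % suc (last t)) (offset-P t r' t≮ℓ) e))
    where
      t≮ℓ : ¬ t < ℓ
      t≮ℓ = ≤⇒≯ ℓ≤t

  cast-step : ∀ {o o' a a' x x' y y'} → o ≡ o' → a ≡ a' → x ≡ x' → y ≡ y' → Step o a x y → Step o' a' x' y'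
  cast-step refl refl refl refl s = s

  minus-cancel : ∀ x r → x ≤ mn → minus x + (x + r) ≡[ mn ] r
  minus-cancel x r x≤mn =
    trans (cong (_% mn) (trans (sym (+-assoc (minus x) x r)) (trans (cong (_+ r) (m∸n+n≡m x≤mn)) (+-comm mn r))))
          (trans (cong (λ z → (r + z) % mn) (sym (*-identityˡ mn))) (add-multiple {mn} r 1))

  minus-step : ∀ x A T → x ≤ mn → A ≡[ mn ] T + x → minus x + A ≡[ mn ] T
  minus-step x A T x≤mn e =
    trans (mod-+ˡ {mn} (minus x) e) (trans (cong (λ z → (minus x + z) % mn) (+-comm T x)) (minus-cancel x T x≤mn))

  -- The steps of Z-template i.  From an even position r < h - 1 the step
  -- goes backwards by 2(r + 1) + 4h·i:  r = -(4h·i + r + 2) + (2(r + 1) + 4h·i).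
  stepZ-even : ∀ i r → i < ℓ → suc r < h → odd r ≡ false →
               Step (forwardZ r) (residueZ r + levelZ i r * twoM) (offsetZ i r) (offsetZ i (suc r))
  stepZ-even i r i<ℓ r+1<h even =
    cast-step (sym (trans (forwardZ-other r r≢last) even))
              (sym (cong₂ (λ ρ u → ρ + u * twoM) (residueZ-other r r≢last) (levelZ-other i r r≢last r≢penult)))
              (sym (offsetZ-even i r r≢last even)) (sym (offsetZ-odd i (suc r) r+1≢last r+1-odd)) back
    where
      r≢last : r ≢ lastZ
      r≢last = <⇒≢ (≤-pred r+1<h)
      r≢penult : r ≢ penultZ
      r≢penult e = false≢true (trans (sym even) (trans (cong odd e) odd-penultZ))
      r+1-odd : odd (suc r) ≡ true
      r+1-odd = cong not even
      r+1≢last : suc r ≢ lastZ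
      r+1≢last e = false≢true (trans (sym odd-lastZ) (trans (cong odd (sym e)) r+1-odd))
      x : ℕ
      x = twoM * i + suc (suc r)
      regroup : ∀ M i r → 2 * suc r + i * M ≡ (M * i + suc (suc r)) + r
      regroup = solve-∀
      back : r ≡[ mn ] minus x + (2 * suc r + i * twoM)
      back = sym (subst (λ z → minus x + z ≡[ mn ] r) (sym (regroup twoM i r)) (minus-cancel x r (below-mn i (suc r) i<ℓ r+1<h)))

  -- From an odd position r < h - 2 it goes forwards by 2(r + 1) + 4h·i:
  -- -(4h·i + r + 1) + (2(r + 1) + 4h·i) = r + 1.
  stepZ-odd : ∀ i r → i < ℓ → suc r < h → odd r ≡ true → r ≢ penultZ →
              Step (forwardZ r) (residueZ r + levelZ i r * twoM) (offsetZ i r) (offsetZ i (suc r))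
  stepZ-odd i r i<ℓ r+1<h odd-r r≢penult =
    cast-step (sym (trans (forwardZ-other r r≢last) odd-r))
              (sym (cong₂ (λ ρ u → ρ + u * twoM) (residueZ-other r r≢last) (levelZ-other i r r≢last r≢penult)))
              (sym (offsetZ-odd i r r≢last odd-r)) (sym (offsetZ-even i (suc r) (r≢penult ∘ suc-injective) (cong not odd-r))) forth
    where
      r≢last : r ≢ lastZ
      r≢last = <⇒≢ (≤-pred r+1<h)
      x : ℕ
      x = twoM * i + suc r
      regroup : ∀ M i r → 2 * suc r + i * M ≡ (M * i + suc r) + suc r
      regroup = solve-∀
      forth : minus x + (2 * suc r + i * twoM) ≡[ mn ] suc r
      forth = subst (λ z → minus x + z ≡[ mn ] suc r) (sym (regroup twoM i r))
                (minus-cancel x (suc r) (below-mn i r i<ℓ (<-trans (≤-pred r+1<h) (n<1+n lastZ))))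

  -- From the penultimate position h - 2 it goes forwards by 2(h - 1) + 4h·(2b - i)
  -- to the last offset, up to a multiple of mn = 4h(2b + 1).
  stepZ-penult : ∀ i → i < ℓ →
                 Step (forwardZ penultZ) (residueZ penultZ + levelZ i penultZ * twoM) (offsetZ i penultZ) (offsetZ i lastZ)
  stepZ-penult i i<ℓ =
    cast-step (sym (trans (forwardZ-other penultZ penultZ≢lastZ) odd-penultZ))
              (sym (cong₂ (λ ρ u → ρ + u * twoM) (residueZ-other penultZ penultZ≢lastZ) (levelZ-penult i)))
              (sym (offsetZ-odd i penultZ penultZ≢lastZ odd-penultZ)) (sym (offsetZ-last i))
              (minus-step x A (lastOffsetZ i) (below-mn i penultZ i<ℓ (<-trans (n<1+n penultZ) (n<1+n lastZ))) A≡)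
    where
      k x A : ℕ
      k = 2 * b ∸ i
      x = twoM * i + suc penultZ
      A = 2 * suc penultZ + k * twoM
      k+i≡2b : k + i ≡ 2 * b
      k+i≡2b = m∸n+n≡m (≤-pred i<ℓ)
      regroup : ∀ a k i → 2 * suc (1 + 2 * a) + k * (2 * (2 * (3 + 2 * a))) + 1 * ((2 * (3 + 2 * a)) * (2 * (1 + (k + i))))
                          ≡ (2 + 2 * a) + 2 * (2 * (3 + 2 * a)) * (2 * k + 1) + (2 * (2 * (3 + 2 * a)) * i + suc (1 + 2 * a))
      regroup = solve-∀
      A≡ : A ≡[ mn ] lastOffsetZ i + x
      A≡ = trans (sym (add-multiple {mn} A 1))
             (cong (_% mn) (trans (cong (λ z → A + 1 * ((2 * h) * (2 * (1 + z)))) (sym k+i≡2b)) (regroup a k i)))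

  stepZ : ∀ i r → i < ℓ → suc r < h → Step (forwardZ r) (residueZ r + levelZ i r * twoM) (offsetZ i r) (offsetZ i (suc r))
  stepZ i r i<ℓ r+1<h with parity-view r
  ... | inj₁ (_ , _ , even) = stepZ-even i r i<ℓ r+1<h even
  ... | inj₂ (_ , _ , odd-r) with dec≡ r penultZ
  ...   | inj₁ refl = stepZ-penult i i<ℓ
  ...   | inj₂ r≢penult = stepZ-odd i r i<ℓ r+1<h odd-r r≢penult

  levelLast-cases : ∀ i → (suc (2 * i) < ℓ × levelLast i ≡ suc (2 * i)) ⊎ (ℓ ≤ suc (2 * i) × levelLast i ≡ suc (2 * i) ∸ ℓ)
  levelLast-cases i with suc (2 * i) <? ℓ
  ... | yes small = inj₁ (small , refl)
  ... | no large = inj₂ (≮⇒≥ large , refl)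

  -- The last step of Z-template i reaches h + offsetZ i 0 = h: with
  -- k = 2b - i, (h - 1) + 4h(2k + 1) + 1 + 4h·levelLast i is h plus a
  -- multiple of mn = 4hℓ, both when levelLast i = 2i + 1 ...
  wrap-sum-small : ∀ i → i < ℓ → lastOffsetZ i + (1 + suc (2 * i) * twoM) ≡[ mn ] h + 0
  wrap-sum-small i i<ℓ = begin
      (lastOffsetZ i + (1 + suc (2 * i) * twoM)) % mn  ≡⟨ cong (_% mn) (trans (regroup a k i) (cong (λ z → h + 0 + 2 * ((2 * h) * (2 * (1 + z)))) k+i≡2b)) ⟩
      (h + 0 + 2 * mn) % mn                            ≡⟨ add-multiple {mn} (h + 0) 2 ⟩
      (h + 0) % mn                                     ∎
    where
      open ≡-Reasoning
      k : ℕ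
      k = 2 * b ∸ i
      k+i≡2b : k + i ≡ 2 * b
      k+i≡2b = m∸n+n≡m (≤-pred i<ℓ)
      regroup : ∀ a k i → (2 + 2 * a) + 2 * (2 * (3 + 2 * a)) * (2 * k + 1) + (1 + suc (2 * i) * (2 * (2 * (3 + 2 * a))))
                           ≡ (3 + 2 * a) + 0 + 2 * ((2 * (3 + 2 * a)) * (2 * (1 + (k + i))))
      regroup = solve-∀

  -- ... and when levelLast i = 2i + 1 - ℓ.
  wrap-sum-large : ∀ i → i < ℓ → ℓ ≤ suc (2 * i) → lastOffsetZ i + (1 + (suc (2 * i) ∸ ℓ) * twoM) ≡[ mn ] h + 0
  wrap-sum-large i i<ℓ large = begin
      X % mn                  ≡⟨ sym (add-multiple {mn} X 1) ⟩
      (X + 1 * mn) % mn       ≡⟨ cong (_% mn) X+mn≡ ⟩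
      (h + 0 + 2 * mn) % mn   ≡⟨ add-multiple {mn} (h + 0) 2 ⟩
      (h + 0) % mn            ∎
    where
      open ≡-Reasoning
      k v X : ℕ
      k = 2 * b ∸ i
      v = suc (2 * i) ∸ ℓ
      X = lastOffsetZ i + (1 + v * twoM)
      k+i≡2b : k + i ≡ 2 * b
      k+i≡2b = m∸n+n≡m (≤-pred i<ℓ)
      -- 2i + 1 = v + ℓ and 2b = k + i force i = v + k
      regroup₁ : ∀ v k i → suc (v + k + i) ≡ v + (1 + (k + i))
      regroup₁ = solve-∀
      v+k≡i : v + k ≡ i
      v+k≡i = +-cancelʳ-≡ i (v + k) i (suc-injective (begin
        suc (v + k + i)      ≡⟨ regroup₁ v k i ⟩
        v + (1 + (k + i))    ≡⟨ cong (λ z → v + (1 + z)) k+i≡2b ⟩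
        v + ℓ                ≡⟨ m∸n+n≡m large ⟩
        suc (2 * i)          ≡⟨ cong suc (cong (i +_) (+-identityʳ i)) ⟩
        suc (i + i)          ∎))
      2b≡ : 2 * b ≡ k + (v + k)
      2b≡ = trans (sym k+i≡2b) (cong (k +_) (sym v+k≡i))
      regroup : ∀ a k v → (2 + 2 * a) + 2 * (2 * (3 + 2 * a)) * (2 * k + 1) + (1 + v * (2 * (2 * (3 + 2 * a))))
                          + 1 * ((2 * (3 + 2 * a)) * (2 * (1 + (k + (v + k)))))
                          ≡ (3 + 2 * a) + 0 + 2 * ((2 * (3 + 2 * a)) * (2 * (1 + (k + (v + k)))))
      regroup = solve-∀
      X+mn≡ : X + 1 * mn ≡ h + 0 + 2 * mn
      X+mn≡ = trans (cong (λ z → X + 1 * ((2 * h) * (2 * (1 + z)))) 2b≡)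
                (trans (regroup a k v) (cong (λ z → h + 0 + 2 * ((2 * h) * (2 * (1 + z)))) (sym 2b≡)))

  wrap-sum : ∀ i → i < ℓ → lastOffsetZ i + (1 + levelLast i * twoM) ≡[ mn ] h + 0
  wrap-sum i i<ℓ with levelLast-cases i
  ... | inj₁ (_ , level≡) =
        subst (λ z → lastOffsetZ i + (1 + z * twoM) ≡[ mn ] h + 0) (sym level≡) (wrap-sum-small i i<ℓ)
  ... | inj₂ (large , level≡) =
        subst (λ z → lastOffsetZ i + (1 + z * twoM) ≡[ mn ] h + 0) (sym level≡) (wrap-sum-large i i<ℓ large)

  0≢lastZ : 0 ≢ lastZ
  0≢lastZ ()

  wrapZ : ∀ i → i < ℓ → Step (forwardZ lastZ) (residueZ lastZ + levelZ i lastZ * twoM) (offsetZ i lastZ) (suc lastZ + offsetZ i 0)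
  wrapZ i i<ℓ = cast-step (sym forwardZ-last) (sym (cong₂ (λ ρ u → ρ + u * twoM) residueZ-last (levelZ-last i))) (sym (offsetZ-last i))
                  (sym (cong (suc lastZ +_) (offsetZ-even i 0 0≢lastZ refl))) (wrap-sum i i<ℓ)

  -- The two steps of P-template s: 0 + (4w + 5 + 4h·q) = offset 1, and
  -- offset 1 = 2 + 0 + (4w + 3 + 4h·q), i.e. back to the next block.
  stepP : ∀ s → Step (forwardP 0) (residueP s 0 + levelP s * twoM) (offsetP s 0) (offsetP s 1)
  stepP s = cong (_% mn) (regroup (levelP s) (columnP s) twoM)
    where
      regroup : ∀ q w M → 0 + (4 * w + 5 + q * M) ≡ M * q + 4 * w + 5
      regroup = solve-∀

  wrapP : ∀ s → Step (forwardP 1) (residueP s 1 + levelP s * twoM) (offsetP s 1) (2 + offsetP s 0)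
  wrapP s = cong (_% mn) (regroup (levelP s) (columnP s) twoM)
    where
      regroup : ∀ q w M → M * q + 4 * w + 5 ≡ 2 + 0 + (4 * w + 3 + q * M)
      regroup = solve-∀

  diff-Z : ∀ t r → t < ℓ → residue t r + level t r * twoM ≡ residueZ r + levelZ t r * twoM
  diff-Z t r t<ℓ = cong₂ (λ ρ u → ρ + u * twoM) (residue-Z t r t<ℓ) (level-Z t r t<ℓ)

  diff-P : ∀ t r → ¬ t < ℓ → residue t r + level t r * twoM ≡ residueP (t ∸ ℓ) r + levelP (t ∸ ℓ) * twoM
  diff-P t r t≮ℓ = cong₂ (λ ρ u → ρ + u * twoM) (residue-P t r t≮ℓ) (level-P t r t≮ℓ)

  step : ∀ t r → t < count → suc r < suc (last t) →
         Step (forward t r) (residue t r + level t r * twoM) (offset t r) (offset t (suc r))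
  step t r _ r+1< with <-≤-connex t ℓ
  ... | inj₁ t<ℓ = cast-step (sym (forward-Z t r t<ℓ)) (sym (diff-Z t r t<ℓ)) (sym (offset-Z t r t<ℓ)) (sym (offset-Z t (suc r) t<ℓ))
                     (stepZ t r t<ℓ (subst (λ z → suc r < suc z) (last-Z t t<ℓ) r+1<))
  ... | inj₂ ℓ≤t with subst (λ z → suc r < suc z) (last-P t (≤⇒≯ ℓ≤t)) r+1<
  ...   | s≤s (s≤s z≤n) = cast-step (sym (forward-P t 0 t≮ℓ)) (sym (diff-P t 0 t≮ℓ)) (sym (offset-P t 0 t≮ℓ)) (sym (offset-P t 1 t≮ℓ))
                            (stepP (t ∸ ℓ))
    where
      t≮ℓ : ¬ t < ℓ
      t≮ℓ = ≤⇒≯ ℓ≤t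

  wrap : ∀ t → t < count →
         Step (forward t (last t)) (residue t (last t) + level t (last t) * twoM) (offset t (last t)) (suc (last t) + offset t 0)
  wrap t _ with <-≤-connex t ℓ
  ... | inj₁ t<ℓ = subst (λ z → Step (forward t z) (residue t z + level t z * twoM) (offset t z) (suc z + offset t 0)) (sym (last-Z t t<ℓ))
                     (cast-step (sym (forward-Z t lastZ t<ℓ)) (sym (diff-Z t lastZ t<ℓ)) (sym (offset-Z t lastZ t<ℓ))
                                (sym (cong (suc lastZ +_) (offset-Z t 0 t<ℓ))) (wrapZ t t<ℓ))
  ... | inj₂ ℓ≤t = subst (λ z → Step (forward t z) (residue t z + level t z * twoM) (offset t z) (suc z + offset t 0)) (sym (last-P t t≮ℓ))
                     (cast-step (sym (forward-P t 1 t≮ℓ)) (sym (diff-P t 1 t≮ℓ)) (sym (offset-P t 1 t≮ℓ))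
                                (sym (cong (2 +_) (offset-P t 0 t≮ℓ))) (wrapP (t ∸ ℓ)))
    where
      t≮ℓ : ¬ t < ℓ
      t≮ℓ = ≤⇒≯ ℓ≤t

  residue>0 : ∀ t r → t < count → r < suc (last t) → 0 < residue t r
  residue>0 t r _ _ with <-≤-connex t ℓ
  ... | inj₁ t<ℓ = subst (0 <_) (sym (residue-Z t r t<ℓ)) (residueZ>0 r)
    where
      residueZ>0 : ∀ r → 0 < residueZ r
      residueZ>0 r with dec≡ r lastZ
      ... | inj₁ refl = subst (0 <_) (sym residueZ-last) (s≤s z≤n)
      ... | inj₂ ne = subst (0 <_) (sym (residueZ-other r ne)) (s≤s z≤n)
  ... | inj₂ ℓ≤t = subst (0 <_) (sym (residue-P t r (≤⇒≯ ℓ≤t))) (residueP>0 r)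
    where
      residueP>0 : ∀ r → 0 < residueP (t ∸ ℓ) r
      residueP>0 zero = subst (0 <_) (+-comm 5 (4 * columnP (t ∸ ℓ))) (s≤s z≤n)
      residueP>0 (suc _) = subst (0 <_) (+-comm 3 (4 * columnP (t ∸ ℓ))) (s≤s z≤n)

  residueP<m : ∀ w c → w < W → c ≤ 5 → 4 * w + c < m
  residueP<m w c w<W c≤5 = begin-strict
      4 * w + c        ≤⟨ +-mono-≤ (*-monoʳ-≤ 4 (≤-pred w<W)) c≤5 ⟩
      4 * a + 5        <⟨ n<1+n (4 * a + 5) ⟩
      suc (4 * a + 5)  ≡⟨ regroup a ⟩
      m                ∎
    where
      open ≤-Reasoning
      regroup : ∀ a → suc (4 * a + 5) ≡ 2 * (3 + 2 * a)
      regroup = solve-∀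

  residue<m : ∀ t r → t < count → r < suc (last t) → residue t r < m
  residue<m t r _ r< with <-≤-connex t ℓ
  ... | inj₁ t<ℓ = subst (_< m) (sym (residue-Z t r t<ℓ)) (residueZ<m r (subst (λ z → r < suc z) (last-Z t t<ℓ) r<))
    where
      residueZ<m : ∀ r → r < h → residueZ r < m
      residueZ<m r r<h with dec≡ r lastZ
      ... | inj₁ refl = subst (_< m) (sym residueZ-last) (s≤s (s≤s z≤n))
      ... | inj₂ ne = subst (_< m) (sym (residueZ-other r ne)) (*-monoʳ-< 2 (s≤s (≤∧≢⇒< (≤-pred r<h) ne)))
  ... | inj₂ ℓ≤t = subst (_< m) (sym (residue-P t r (≤⇒≯ ℓ≤t))) (residueP<m′ r)
    where
      residueP<m′ : ∀ r → residueP (t ∸ ℓ) r < m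
      residueP<m′ zero = residueP<m (columnP (t ∸ ℓ)) 5 (m%n<n (t ∸ ℓ) W) ≤-refl
      residueP<m′ (suc _) = residueP<m (columnP (t ∸ ℓ)) 3 (m%n<n (t ∸ ℓ) W) (s≤s (s≤s (s≤s z≤n)))

  levelLast<ℓ : ∀ i → i < ℓ → levelLast i < ℓ
  levelLast<ℓ i i<ℓ with levelLast-cases i
  ... | inj₁ (small , e) = subst (_< ℓ) (sym e) small
  ... | inj₂ (large , e) = subst (_< ℓ) (sym e) v<ℓ
    where
      v : ℕ
      v = suc (2 * i) ∸ ℓ
      regroup : ∀ i → 2 * suc i ≡ suc (suc (2 * i))
      regroup = solve-∀
      -- 2i + 1 < 2ℓ, so 2i + 1 - ℓ < ℓ
      v<ℓ : v < ℓ
      v<ℓ = +-cancelʳ-< ℓ v ℓ (subst (_< ℓ + ℓ) (sym (m∸n+n≡m large))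
              (subst₂ _≤_ (regroup i) (cong (ℓ +_) (+-identityʳ ℓ)) (*-monoʳ-≤ 2 i<ℓ)))

  level<ℓ : ∀ t r → t < count → r < suc (last t) → level t r < ℓ
  level<ℓ t r t<count _ with <-≤-connex t ℓ
  ... | inj₁ t<ℓ = subst (_< ℓ) (sym (level-Z t r t<ℓ)) (levelZ<ℓ r)
    where
      levelZ<ℓ : ∀ r → levelZ t r < ℓ
      levelZ<ℓ r with dec≡ r lastZ | dec≡ r penultZ
      ... | inj₁ refl | _ = subst (_< ℓ) (sym (levelZ-last t)) (levelLast<ℓ t t<ℓ)
      ... | inj₂ _ | inj₁ refl = subst (_< ℓ) (sym (levelZ-penult t)) (s≤s (m∸n≤m (2 * b) t))
      ... | inj₂ n1 | inj₂ n2 = subst (_< ℓ) (sym (levelZ-other t r n1 n2)) t<ℓ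
  ... | inj₂ ℓ≤t = subst (_< ℓ) (sym (level-P t r (≤⇒≯ ℓ≤t))) (m<n*o⇒m/o<n {t ∸ ℓ} {ℓ} {W} s<ℓW)
    where
      s<ℓW : t ∸ ℓ < ℓ * W
      s<ℓW = +-cancelʳ-< ℓ (t ∸ ℓ) (ℓ * W) (subst₂ _<_ (sym (m∸n+n≡m ℓ≤t)) (+-comm ℓ (ℓ * W)) t<count)

  decodeEven-penult : ∀ u → decodeEven (suc penultZ) u ≡ (2 * b ∸ u , penultZ)
  decodeEven-penult u with penultZ ≟ penultZ
  ... | yes _ = refl
  ... | no ne = ⊥-elim (ne refl)

  decodeEven-other : ∀ r u → r ≢ penultZ → decodeEven (suc r) u ≡ (u , r)
  decodeEven-other r u ne with r ≟ penultZ
  ... | yes e = ⊥-elim (ne e)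
  ... | no _ = refl

  decode-parity : ∀ p k u → p < 2 → decode (p + k * 2) u ≡ decode-by-parity p k u
  decode-parity p k u p<2 = cong₂ (λ x y → decode-by-parity x y u) (rem-unique {2} k p p<2) (quot-unique {2} k p p<2)

  levelLast⁻¹-parity : ∀ p k → p < 2 → levelLast⁻¹ (p + k * 2) ≡ levelLast⁻¹-by-parity p k
  levelLast⁻¹-parity p k p<2 = cong₂ levelLast⁻¹-by-parity (rem-unique {2} k p p<2) (quot-unique {2} k p p<2)

  decodeOdd-parity : ∀ p k u → p < 2 → decodeOdd (suc (p + k * 2)) u ≡ decodeOdd-by-parity p k u
  decodeOdd-parity p k u p<2 = cong₂ (λ x y → decodeOdd-by-parity x y u) (rem-unique {2} k p p<2) (quot-unique {2} k p p<2)

  -- levelLast⁻¹ is a left inverse of levelLast: for 2i + 1 < ℓ the level is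
  -- odd with half i, otherwise it is 2(i - b), even with half i - b.
  levelLast⁻¹-levelLast : ∀ i → i < ℓ → levelLast⁻¹ (levelLast i) ≡ i
  levelLast⁻¹-levelLast i _ with levelLast-cases i
  ... | inj₁ (_ , e) = trans (cong levelLast⁻¹ (trans e (cong suc (*-comm 2 i)))) (levelLast⁻¹-parity 1 i (s≤s (s≤s z≤n)))
  ... | inj₂ (large , e) = trans (cong levelLast⁻¹ (trans e level≡)) (trans (levelLast⁻¹-parity 0 c (s≤s z≤n)) (m∸n+n≡m b≤i))
    where
      b≤i : b ≤ i
      b≤i = *-cancelˡ-≤ 2 (≤-pred large)
      c : ℕ
      c = i ∸ b
      regroup : ∀ c b → suc (2 * (c + b)) ≡ c * 2 + (1 + 2 * b)
      regroup = solve-∀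
      level≡ : suc (2 * i) ∸ ℓ ≡ 0 + c * 2
      level≡ = trans (cong (λ z → suc (2 * z) ∸ ℓ) (sym (m∸n+n≡m b≤i))) (trans (cong (_∸ ℓ) (regroup c b)) (m+n∸n≡m (c * 2) ℓ))

  -- levelLast⁻¹ inverts levelLast on levels below ℓ: an odd level 2k + 1
  -- comes from i = k, an even level 2k from i = k + b, as 2(k + b) + 1 - ℓ = 2k.
  levelLast-inverse-odd : ∀ k → 1 + k * 2 < ℓ → k < ℓ × levelLast k ≡ 1 + k * 2
  levelLast-inverse-odd k u<ℓ = k<ℓ , level≡
    where
      odd≡ : suc (2 * k) ≡ 1 + k * 2
      odd≡ = cong suc (*-comm 2 k)
      k<ℓ : k < ℓ
      k<ℓ = ≤-<-trans (≤-trans (m≤m+n k (k + 0)) (n≤1+n (2 * k))) (subst (_< ℓ) (sym odd≡) u<ℓ)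
      level≡ : levelLast k ≡ 1 + k * 2
      level≡ with levelLast-cases k
      ... | inj₁ (_ , e) = trans e odd≡
      ... | inj₂ (large , _) = ⊥-elim (<-irrefl refl (<-≤-trans u<ℓ (subst (ℓ ≤_) odd≡ large)))

  levelLast-inverse-even : ∀ k → k * 2 < ℓ → k + b < ℓ × levelLast (k + b) ≡ k * 2
  levelLast-inverse-even k u<ℓ = k+b<ℓ , level≡
    where
      regroup : ∀ k b → suc (2 * (k + b)) ≡ k * 2 + (1 + 2 * b)
      regroup = solve-∀
      k≤b : k ≤ b
      k≤b = *-cancelʳ-≤ k b 2 (≤-pred (subst (k * 2 <_) (cong suc (*-comm 2 b)) u<ℓ))
      k+b<ℓ : k + b < ℓ
      k+b<ℓ = s≤s (subst (k + b ≤_) (cong (b +_) (sym (+-identityʳ b))) (+-monoˡ-≤ b k≤b))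
      level≡ : levelLast (k + b) ≡ k * 2
      level≡ with levelLast-cases (k + b)
      ... | inj₁ (small , _) = ⊥-elim (<-irrefl refl (<-≤-trans small (subst (ℓ ≤_) (sym (regroup k b)) (m≤n+m ℓ (k * 2)))))
      ... | inj₂ (_ , e) = trans e (trans (cong (_∸ ℓ) (regroup k b)) (m+n∸n≡m (k * 2) ℓ))

  levelLast-levelLast⁻¹ : ∀ u → u < ℓ → levelLast⁻¹ u < ℓ × levelLast (levelLast⁻¹ u) ≡ u
  levelLast-levelLast⁻¹ u u<ℓ with parity-view u
  ... | inj₁ (k , refl , _) = subst (λ i → i < ℓ × levelLast i ≡ k * 2) (sym (levelLast⁻¹-parity 0 k (s≤s z≤n)))
                                (levelLast-inverse-even k u<ℓ)
  ... | inj₂ (k , refl , _) = subst (λ i → i < ℓ × levelLast i ≡ 1 + k * 2) (sym (levelLast⁻¹-parity 1 k (s≤s (s≤s z≤n))))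
                                (levelLast-inverse-odd k u<ℓ)

  Decodes : ℕ → ℕ → ℕ × ℕ → Set
  Decodes ρ u X = proj₁ X < count × proj₂ X < suc (last (proj₁ X)) × residue (proj₁ X) (proj₂ X) ≡ ρ × level (proj₁ X) (proj₂ X) ≡ u

  Z<count : ∀ {t} → t < ℓ → t < count
  Z<count t<ℓ = ≤-trans t<ℓ (m≤m+n ℓ (ℓ * W))

  m≡4W+2 : m ≡ 4 * W + 2
  m≡4W+2 = regroup a
    where
      regroup : ∀ a → 2 * (3 + 2 * a) ≡ 4 * (1 + a) + 2
      regroup = solve-∀

  column-bound : ∀ w → 4 * w + 3 < m → w < W
  column-bound w ρ<m with w <? W
  ... | yes w<W = w<W
  ... | no w≮W = ⊥-elim (4≰2 (+-cancelˡ-≤ (4 * W) 4 2 chain))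
    where
      4≰2 : ¬ (4 ≤ 2)
      4≰2 (s≤s (s≤s ()))
      chain : 4 * W + 4 ≤ 4 * W + 2
      chain = ≤-trans (+-monoˡ-≤ 4 (*-monoʳ-≤ 4 (≮⇒≥ w≮W)))
                (≤-trans (≤-reflexive (+-suc (4 * w) 3)) (subst (suc (4 * w + 3) ≤_) m≡4W+2 ρ<m))

  columnP-eq : ∀ u w → w < W → columnP (u * W + w) ≡ w
  columnP-eq u w w<W = trans (cong (_% W) (+-comm (u * W) w)) (rem-unique {W} u w w<W)

  decodes-P : ∀ ρ u w r → u < ℓ → w < W → r < 2 → residueP (u * W + w) r ≡ ρ → Decodes ρ u (ℓ + u * W + w , r)
  decodes-P ρ u w r u<ℓ w<W r<2 residue≡ =
    T<count , subst (λ z → r < suc z) (sym (last-P T T≮ℓ)) r<2 ,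
    trans (residue-P T r T≮ℓ) (trans (cong (λ z → residueP z r) T-ℓ≡) residue≡) ,
    trans (level-P T r T≮ℓ) (trans (cong levelP T-ℓ≡) (trans (cong (_/ W) (+-comm (u * W) w)) (quot-unique {W} u w w<W)))
    where
      T : ℕ
      T = ℓ + u * W + w
      T-ℓ≡ : T ∸ ℓ ≡ u * W + w
      T-ℓ≡ = trans (cong (_∸ ℓ) (+-assoc ℓ (u * W) w)) (m+n∸m≡n ℓ (u * W + w))
      T≮ℓ : ¬ T < ℓ
      T≮ℓ T<ℓ = <-irrefl refl (<-≤-trans T<ℓ (≤-trans (m≤m+n ℓ (u * W)) (m≤m+n (ℓ + u * W) w)))
      T<count : T < count
      T<count = subst (_< count) (sym (+-assoc ℓ (u * W) w))
                  (+-monoʳ-< ℓ (≤-trans (+-monoʳ-< (u * W) w<W) (subst (_≤ ℓ * W) (+-comm W (u * W)) (*-monoˡ-≤ W u<ℓ))))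

  decodes-even : ∀ r u → suc r * 2 < m → u < ℓ → Decodes (suc r * 2) u (decodeEven (suc r) u)
  decodes-even r u ρ<m u<ℓ with dec≡ r penultZ
  ... | inj₁ refl = subst (Decodes (suc penultZ * 2) u) (sym (decodeEven-penult u)) (Z<count t<ℓ , penult< , residue≡ , level≡)
    where
      t : ℕ
      t = 2 * b ∸ u
      t<ℓ : t < ℓ
      t<ℓ = s≤s (m∸n≤m (2 * b) u)
      penult< : penultZ < suc (last t)
      penult< = subst (λ z → penultZ < suc z) (sym (last-Z t t<ℓ)) (<-trans (n<1+n penultZ) (n<1+n lastZ))
      residue≡ : residue t penultZ ≡ suc penultZ * 2
      residue≡ = trans (residue-Z t penultZ t<ℓ) (trans (residueZ-other penultZ penultZ≢lastZ) (*-comm 2 (suc penultZ)))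
      level≡ : level t penultZ ≡ u
      level≡ = trans (level-Z t penultZ t<ℓ) (trans (levelZ-penult t) (m∸[m∸n]≡n (≤-pred u<ℓ)))
  ... | inj₂ r≢penult = subst (Decodes (suc r * 2) u) (sym (decodeEven-other r u r≢penult)) (Z<count u<ℓ , r< , residue≡ , level≡)
    where
      r+1<h : suc r < h
      r+1<h = *-cancelʳ-< 2 (suc r) h (subst (suc r * 2 <_) (*-comm 2 h) ρ<m)
      r≢last : r ≢ lastZ
      r≢last = <⇒≢ (≤-pred r+1<h)
      r< : r < suc (last u)
      r< = subst (λ z → r < suc z) (sym (last-Z u u<ℓ)) (<-trans (n<1+n r) r+1<h)
      residue≡ : residue u r ≡ suc r * 2
      residue≡ = trans (residue-Z u r u<ℓ) (trans (residueZ-other r r≢last) (*-comm 2 (suc r)))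
      level≡ : level u r ≡ u
      level≡ = trans (level-Z u r u<ℓ) (levelZ-other u r r≢last r≢penult)

  decodes-one : ∀ u → u < ℓ → Decodes 1 u (decodeOdd 0 u)
  decodes-one u u<ℓ = Z<count i<ℓ , last< , residue≡ , level≡
    where
      i : ℕ
      i = levelLast⁻¹ u
      i<ℓ : i < ℓ
      i<ℓ = proj₁ (levelLast-levelLast⁻¹ u u<ℓ)
      last< : lastZ < suc (last i)
      last< = subst (λ z → lastZ < suc z) (sym (last-Z i i<ℓ)) (n<1+n lastZ)
      residue≡ : residue i lastZ ≡ 1
      residue≡ = trans (residue-Z i lastZ i<ℓ) residueZ-last
      level≡ : level i lastZ ≡ u
      level≡ = trans (level-Z i lastZ i<ℓ) (trans (levelZ-last i) (proj₂ (levelLast-levelLast⁻¹ u u<ℓ)))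

  decodes-odd : ∀ k u → 1 + suc k * 2 < m → u < ℓ → Decodes (1 + suc k * 2) u (decodeOdd (suc k) u)
  decodes-odd k u ρ<m u<ℓ with parity-view k
  ... | inj₁ (w , refl , _) = subst (Decodes ρ u) (sym (decodeOdd-parity 0 w u (s≤s z≤n)))
                                (decodes-P ρ u w 1 u<ℓ w<W (s≤s (s≤s z≤n)) (trans (cong (λ z → 4 * z + 3) (columnP-eq u w w<W)) (sym ρ≡)))
    where
      ρ : ℕ
      ρ = 1 + suc (w * 2) * 2
      regroup : ∀ w → 1 + suc (w * 2) * 2 ≡ 4 * w + 3
      regroup = solve-∀
      ρ≡ : ρ ≡ 4 * w + 3
      ρ≡ = regroup w
      w<W : w < W
      w<W = column-bound w (subst (_< m) ρ≡ ρ<m)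
  ... | inj₂ (w , refl , _) = subst (Decodes ρ u) (sym (decodeOdd-parity 1 w u (s≤s (s≤s z≤n))))
                                (decodes-P ρ u w 0 u<ℓ w<W (s≤s z≤n) (trans (cong (λ z → 4 * z + 5) (columnP-eq u w w<W)) (sym ρ≡)))
    where
      ρ : ℕ
      ρ = 1 + suc (1 + w * 2) * 2
      regroup : ∀ w → 1 + suc (1 + w * 2) * 2 ≡ 4 * w + 5
      regroup = solve-∀
      ρ≡ : ρ ≡ 4 * w + 5
      ρ≡ = regroup w
      w<W : w < W
      w<W = column-bound w (≤-trans (s≤s (+-monoʳ-≤ (4 * w) (s≤s (s≤s (s≤s (z≤n {2})))))) (subst (_< m) ρ≡ ρ<m))

  decode-sound : ∀ ρ u → 0 < ρ → ρ < m → u < ℓ → Decodes ρ u (decode ρ u)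
  decode-sound ρ u ρ>0 ρ<m u<ℓ with parity-view ρ
  ... | inj₁ (zero , refl , _) = ⊥-elim (<-irrefl refl ρ>0)
  ... | inj₁ (suc r , refl , _) = subst (Decodes _ u) (sym (decode-parity 0 (suc r) u (s≤s z≤n))) (decodes-even r u ρ<m u<ℓ)
  ... | inj₂ (zero , refl , _) = subst (Decodes _ u) (sym (decode-parity 1 0 u (s≤s (s≤s z≤n)))) (decodes-one u u<ℓ)
  ... | inj₂ (suc k , refl , _) = subst (Decodes _ u) (sym (decode-parity 1 (suc k) u (s≤s (s≤s z≤n)))) (decodes-odd k u ρ<m u<ℓ)

  decode-inverse-Z : ∀ t r → t < ℓ → decode (residue t r) (level t r) ≡ (t , r)
  decode-inverse-Z t r t<ℓ with dec≡ r lastZ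
  ... | inj₁ refl = trans (cong₂ decode (trans (residue-Z t lastZ t<ℓ) residueZ-last) (trans (level-Z t lastZ t<ℓ) (levelZ-last t)))
                      (cong (λ z → z , lastZ) (levelLast⁻¹-levelLast t t<ℓ))
  ... | inj₂ r≢last = trans (cong₂ decode (trans (residue-Z t r t<ℓ) (trans (residueZ-other r r≢last) (*-comm 2 (suc r)))) (level-Z t r t<ℓ))
                        (trans (decode-parity 0 (suc r) (levelZ t r) (s≤s z≤n)) even-case)
    where
      even-case : decodeEven (suc r) (levelZ t r) ≡ (t , r)
      even-case with dec≡ r penultZ
      ... | inj₁ refl = trans (cong (decodeEven (suc penultZ)) (levelZ-penult t))
                          (trans (decodeEven-penult (2 * b ∸ t)) (cong (λ z → z , penultZ) (m∸[m∸n]≡n (≤-pred t<ℓ))))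
      ... | inj₂ r≢penult = trans (cong (decodeEven (suc r)) (levelZ-other t r r≢last r≢penult)) (decodeEven-other r t r≢penult)

  template≡ : ∀ t → ℓ ≤ t → ℓ + levelP (t ∸ ℓ) * W + columnP (t ∸ ℓ) ≡ t
  template≡ t ℓ≤t = trans (+-assoc ℓ _ _)
    (trans (cong (ℓ +_) (trans (+-comm _ (columnP (t ∸ ℓ))) (sym (divmod {W} (t ∸ ℓ))))) (m+[n∸m]≡n ℓ≤t))

  decode-inverse-P : ∀ t r → ℓ ≤ t → r < 2 → decode (residue t r) (level t r) ≡ (t , r)
  decode-inverse-P t zero ℓ≤t _ = trans (cong₂ decode (trans (residue-P t 0 (≤⇒≯ ℓ≤t)) (regroup w)) (level-P t 0 (≤⇒≯ ℓ≤t)))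
                                    (trans (decode-parity 1 (suc (1 + w * 2)) q (s≤s (s≤s z≤n)))
                                    (trans (decodeOdd-parity 1 w q (s≤s (s≤s z≤n))) (cong (λ z → z , 0) (template≡ t ℓ≤t))))
    where
      q w : ℕ
      q = levelP (t ∸ ℓ)
      w = columnP (t ∸ ℓ)
      regroup : ∀ w → 4 * w + 5 ≡ 1 + suc (1 + w * 2) * 2
      regroup = solve-∀
  decode-inverse-P t (suc zero) ℓ≤t _ = trans (cong₂ decode (trans (residue-P t 1 (≤⇒≯ ℓ≤t)) (regroup w)) (level-P t 1 (≤⇒≯ ℓ≤t)))
                                          (trans (decode-parity 1 (suc (0 + w * 2)) q (s≤s (s≤s z≤n)))
                                          (trans (decodeOdd-parity 0 w q (s≤s z≤n)) (cong (λ z → z , 1) (template≡ t ℓ≤t))))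
    where
      q w : ℕ
      q = levelP (t ∸ ℓ)
      w = columnP (t ∸ ℓ)
      regroup : ∀ w → 4 * w + 3 ≡ 1 + suc (0 + w * 2) * 2
      regroup = solve-∀
  decode-inverse-P t (suc (suc _)) _ (s≤s (s≤s ()))

  decode-inverse : ∀ t r → t < count → r < suc (last t) → decode (residue t r) (level t r) ≡ (t , r)
  decode-inverse t r _ r< with <-≤-connex t ℓ
  ... | inj₁ t<ℓ = decode-inverse-Z t r t<ℓ
  ... | inj₂ ℓ≤t = decode-inverse-P t r ℓ≤t (subst (λ z → r < suc z) (last-P t (≤⇒≯ ℓ≤t)) r<)

  design : Design
  design = record { count = count ; last = last ; offset = offset ; residue = residue ; level = level ; forward = forward ; decode = decode
                  ; period∣m = period∣m ; offset-injective = offset-injective ; step = step ; wrap = wrap ; residue>0 = residue>0 ; residue<m = residue<m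
                  ; level<ℓ = level<ℓ ; decode-sound = decode-sound ; decode-inverse = decode-inverse }

  cyclicSystem : Σ (HCS m n) λ S → Cyclic m n S × PhiSymmetric m n S
  cyclicSystem = Build.cyclicSystem design


module TwoModFour where
  open import Data.Nat
  open import Data.Nat.DivMod
  open import Data.Nat.Tactic.RingSolver
  open import Data.Product
  open import Data.Sum
  open import Relation.Binary.PropositionalEquality
  open Congruence

  two-mod-four : ∀ n → n % 4 ≡ 2 → Σ ℕ λ b → n ≡ 2 * (1 + 2 * b)
  two-mod-four n n%4≡2 = n / 4 , trans (divmod {4} n) (trans (cong (λ z → z + (n / 4) * 4) n%4≡2) (regroup (n / 4)))
    where
      regroup : ∀ b → 2 + b * 4 ≡ 2 * (1 + 2 * b)
      regroup = solve-∀

  two-mod-four-cases : ∀ m → m % 4 ≡ 2 → m ≡ 2 ⊎ Σ ℕ λ a → m ≡ 2 * (3 + 2 * a)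
  two-mod-four-cases m m%4≡2 with two-mod-four m m%4≡2
  ... | zero , m≡2 = inj₁ m≡2
  ... | suc a , m≡ = inj₂ (a , trans m≡ (regroup a))
    where
      regroup : ∀ a → 2 * (1 + 2 * suc a) ≡ 2 * (3 + 2 * a)
      regroup = solve-∀

open TwoModFour
open import Data.Sum using (inj₁; inj₂)
open import Data.Product using (_,_)
open import Relation.Binary.PropositionalEquality using (refl)

theorem4p9 : (m n : ℕ) .{{_ : NonZero m}} .{{_ : NonZero n}} →
    m % 4 ≡ 2 → n % 4 ≡ 2 →
    Σ (HCS m n) λ S → Cyclic m n S × PhiSymmetric m n S
theorem4p9 m n m%4≡2 n%4≡2 with two-mod-four-cases m m%4≡2 | two-mod-four n n%4≡2
... | inj₁ refl | b , refl = SmallDesign.cyclicSystem b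
... | inj₂ (a , refl) | b , refl = LargeDesign.cyclicSystem a b
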